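{- Let $d\ge2$, let $\boldsymbol{\lambda}=(\lambda^{(0)},\ldots,\lambda^{(d-1)})$ be a $d$-tuple of skew diagrams and $0\le i\le d-2$ such that $\lambda^{(i)}$ is a horizontal domino with content set $\{0,1\}$ and $\lambda^{(i+1)}$ is a vertical domino with content set $\{0,1\}$. Let $\boldsymbol{\mu}$ be obtained from $\boldsymbol{\lambda}$ by swapping $\lambda^{(i)}$ and $\lambda^{(i+1)}$. Then $\tilde G_{\boldsymbol{\lambda}}[X;q]=\tilde G_{\boldsymbol{\mu}}[X;q]$.
   Context: English notation; content of the cell in row $r$, column $c$ is $c-r$. A horizontal domino with content set $\{0,1\}$: two cells in the same row, adjacent columns, contents $0$ (left) and $1$ (right). A vertical domino with content set $\{0,1\}$: two cells in the same column, adjacent rows, contents $1$ (upper) and $0$ (lower). For a $d$-tuple of skew diagrams, the shifted content of a cell $x$ of $\lambda^{(i)}$ is $\tilde c(x)=d\,c(x)+i$. A semistandard filling $T$ fills each $\lambda^{(i)}$ as a semistandard skew tableau (rows weakly increasing, columns strictly increasing); $\mathrm{Inv}(T)$ is the set of pairs of cells $(x,y)$ with $0<\tilde c(y)-\tilde c(x)<d$ and $T(x)>T(y)$; $\tilde G_{\boldsymbol{\lambda}}[X;q]=\sum_Tq^{|\mathrm{Inv}(T)|}\prod_xx_{T(x)}$. -}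

module Defs where

open import Data.Nat as ℕ using (ℕ; zero; suc; _∸_; _≤_; _<_)
open import Data.Integer as ℤ using (ℤ; +_)
open import Data.Fin as Fin using (Fin; toℕ; fromℕ<)
open import Data.Bool using (Bool; true; false; if_then_else_; _∧_; _∨_; not)
open import Data.List using (List; []; _∷_; length; map; concatMap; applyUpTo; upTo; zip; allFin)
open import Data.Nat.ListAction using (sum)
open import Data.Bool.ListAction using (all)
open import Data.Product using (_×_; _,_; proj₁; proj₂)
open import Relation.Nullary.Decidable using (⌊_⌋)

-- Partitions and skew diagrams (English notation, rows and columns
-- indexed from 0; the cell in row r, column c has content c - r).

part : List ℕ → ℕ → ℕ
part []       _       = 0
part (x ∷ _)  zero    = x
part (_ ∷ xs) (suc r) = part xs r

IsPartition : List ℕ → Set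
IsPartition l = ∀ r → part l (suc r) ≤ part l r

record SkewDiagram : Set where
  field
    outer     : List ℕ
    inner     : List ℕ
    outerPart : IsPartition outer
    innerPart : IsPartition inner
    contained : ∀ r → part inner r ≤ part outer r
open SkewDiagram public

-- a cell: (row , column)
Cell : Set
Cell = ℕ × ℕ

cells : SkewDiagram → List Cell
cells s = concatMap rowCells (upTo (length (outer s)))
  where
  rowCells : ℕ → List Cell
  rowCells r = map (λ c → (r , c))
                   (applyUpTo (λ c → part (inner s) r ℕ.+ c) (part (outer s) r ∸ part (inner s) r))

content : Cell → ℤ
content (r , c) = + c ℤ.- + r

open import Data.List.Membership.Propositional using (_∈_)
open import Relation.Binary.PropositionalEquality using (_≡_)
open import Data.Sum using (_⊎_)
open import Data.Product using (∃)
open import Function.Bundles using (_⇔_)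

IsHorizontalDomino01 : SkewDiagram → Set
IsHorizontalDomino01 s =
  ∃ λ r → ∀ x → (x ∈ cells s) ⇔ (x ≡ (r , r) ⊎ x ≡ (r , suc r))

IsVerticalDomino01 : SkewDiagram → Set
IsVerticalDomino01 s =
  ∃ λ r → ∀ x → (x ∈ cells s) ⇔ (x ≡ (r , suc r) ⊎ x ≡ (suc r , suc r))

Tuple : ℕ → Set
Tuple d = Fin d → SkewDiagram

TCell : ℕ → Set
TCell d = Fin d × Cell

allCells : ∀ {d} → Tuple d → List (TCell d)
allCells {d} lam = concatMap (λ i → map (i ,_) (cells (lam i))) (allFin d)

shiftedContent : ∀ d → TCell d → ℤ
shiftedContent d (i , x) = + d ℤ.* content x ℤ.+ + toℕ i

-- Fillings.  A filling of a tuple is a list of positive integers, one for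
-- each cell of  allCells lam  (in that order).

words : ℕ → ℕ → List (List ℕ)
words m zero    = [] ∷ []
words m (suc N) = concatMap (λ v → map (v ∷_) (words m N)) (applyUpTo suc m)

pairsOf : ∀ {A : Set} → List A → List (A × A)
pairsOf xs = concatMap (λ x → map (x ,_) xs) xs

countB : ∀ {A : Set} → (A → Bool) → List A → ℕ
countB f xs = sum (map (λ x → if f x then 1 else 0) xs)

module _ {d : ℕ} where
  Labelled : Set
  Labelled = TCell d × ℕ

  -- semistandard condition on one ordered pair of filled cells:
  -- in the same component, rows weakly increase, columns strictly increase
  ssPair : Labelled × Labelled → Bool
  ssPair (((i , (r , c)) , a) , ((j , (r' , c')) , b)) =
    not ⌊ i Fin.≟ j ⌋
    ∨ ((not (⌊ r ℕ.≟ r' ⌋ ∧ ⌊ c ℕ.<? c' ⌋) ∨ ⌊ a ℕ.≤? b ⌋)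
       ∧ (not (⌊ c ℕ.≟ c' ⌋ ∧ ⌊ r ℕ.<? r' ⌋) ∨ ⌊ a ℕ.<? b ⌋))

  invPair : Labelled × Labelled → Bool
  invPair ((x , a) , (y , b)) =
    ⌊ + 0 ℤ.<? (shiftedContent d y ℤ.- shiftedContent d x) ⌋
    ∧ ⌊ (shiftedContent d y ℤ.- shiftedContent d x) ℤ.<? + d ⌋
    ∧ ⌊ b ℕ.<? a ⌋

semistandard : ∀ {d} → Tuple d → List ℕ → Bool
semistandard lam T = all ssPair (pairsOf (zip (allCells lam) T))

inv : ∀ {d} → Tuple d → List ℕ → ℕ
inv lam T = countB invPair (pairsOf (zip (allCells lam) T))

weight : ℕ → List ℕ → List ℕ
weight m T = map (λ j → countB (λ v → ⌊ v ℕ.≟ suc j ⌋) T) (upTo m)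

open import Data.List.Properties using (≡-dec)
open import Data.Nat.Properties using (<-trans; n<1+n)

-- coefficient of  q^k x_1^{α_1} ⋯ x_m^{α_m}  in  G̃_λ[X;q]
-- (m = length α), i.e. the number of semistandard fillings of weight α
-- with exactly k inversions
coeffG : ∀ {d} → Tuple d → List ℕ → ℕ → ℕ
coeffG lam α k =
  countB (λ T → semistandard lam T
                ∧ ⌊ ≡-dec ℕ._≟_ (weight (length α) T) α ⌋
                ∧ ⌊ inv lam T ℕ.≟ k ⌋)
         (words (length α) (length (allCells lam)))

swapTuple : ∀ {d} → Fin d → Fin d → Tuple d → Tuple d
swapTuple a b lam j =
  if ⌊ j Fin.≟ a ⌋ then lam b else (if ⌊ j Fin.≟ b ⌋ then lam a else lam j)

posI : ∀ {d} i → suc i < d → Fin d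
posI i h = fromℕ< (<-trans (n<1+n i) h)

posI+1 : ∀ {d} i → suc i < d → Fin d
posI+1 i h = fromℕ< h

-- Split a filling into the four letters on the two dominoes and the letters outside.  A cell
-- outside lies in a component j ∉ {i , i + 1}, so its shifted content is ≢ i, i + 1 (mod d) and
-- it forms an inversion with shifted content i exactly when it does with i + 1, and likewise
-- for d + i and d + i + 1.  Hence the rest of the filling only sees which two letters sit at
-- shifted contents {i , i + 1} and which two at {d + i , d + i + 1}.  For fixed outside letters,
-- an explicit bijection, a permutation of the four letters on each of four regions, matches the
-- fillings of the swapped block while keeping the letters, these two pairs, and the number of
-- inversions inside the block; on each region the count is reindexed by that permutation.

module Submission where

open import Defs
open import Algebra.Bundles using (CommutativeMonoid)
open import Data.Bool using (Bool; true; false; if_then_else_; _∧_; not)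
open import Data.Bool.ListAction using (and; all)
open import Data.Bool.Properties using (∧-assoc; ∧-comm; ∧-identityʳ; ∧-zeroʳ; ∧-commutativeMonoid)
open import Data.Empty using (⊥-elim)
open import Data.Fin as Fin using (Fin; toℕ)
import Data.Fin.Properties as FinP
open import Data.Integer as ℤ using (ℤ; +_; _⊖_)
import Data.Integer.Properties as ℤP
import Data.Integer.Tactic.RingSolver as ℤSolver
open import Data.List using (List; []; _∷_; _++_; length; map; concat; concatMap; applyUpTo; upTo; zip; allFin)
open import Data.List.Membership.Propositional using (_∈_)
import Data.List.Properties as ListP
open import Data.List.Properties using (≡-dec)
open import Data.List.Relation.Binary.Permutation.Propositional
  using (_↭_; refl; prep; swap; ↭-trans; ↭-reflexive; ↭⇒↭ₛ)
open import Data.List.Relation.Binary.Permutation.Propositional.Properties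
  using (map⁺; ++⁺ˡ; ++⁺ʳ; ++-comm)
open import Data.List.Relation.Binary.Permutation.Setoid.Properties using (foldr-commMonoid)
open import Data.List.Relation.Unary.All as All using (All; []; _∷_)
import Data.List.Relation.Unary.All.Properties as All
open import Data.List.Relation.Unary.AllPairs using (AllPairs; []; _∷_)
import Data.List.Relation.Unary.AllPairs.Properties as AllPairs
open import Data.List.Relation.Unary.Any using (here; there)
open import Data.Nat as ℕ using (ℕ; zero; suc; _+_; _*_; _≤_; _<_; _≤?_; _<?_)
open import Data.Nat.DivMod using (_%_; [m+kn]%n≡m%n; m<n⇒m%n≡m)
open import Data.Nat.ListAction using (sum)
open import Data.Nat.ListAction.Properties using (sum-++; sum-↭)
import Data.Nat.Properties as ℕP
open import Data.Nat.Tactic.RingSolver using (solve-∀)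
open import Data.Product using (_×_; _,_; proj₁; proj₂)
open import Data.Product.Relation.Binary.Lex.Strict using (×-Lex; ×-asymmetric)
open import Data.Sum using (_⊎_; inj₁; inj₂)
open import Function using (_∘_; id)
open import Function.Bundles using (_⇔_; Equivalence)
open import Relation.Binary.Definitions using (Asymmetric)
open import Relation.Binary.PropositionalEquality hiding (J)
open import Relation.Nullary using (Dec; yes; no; ¬_)
open import Relation.Nullary.Decidable using (⌊_⌋)

open import Algebra.Properties.CommutativeSemigroup ℕP.+-commutativeSemigroup
  using () renaming (interchange to +-interchange)
open import Algebra.Properties.CommutativeSemigroup
  (CommutativeMonoid.commutativeSemigroup ∧-commutativeMonoid)
  using () renaming (interchange to ∧-interchange)

private
  variable
    A B : Set

⌊⌋-true : (a? : Dec A) → A → ⌊ a? ⌋ ≡ true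
⌊⌋-true (yes _) _ = refl
⌊⌋-true (no ¬a) a = ⊥-elim (¬a a)

⌊⌋-false : (a? : Dec A) → ¬ A → ⌊ a? ⌋ ≡ false
⌊⌋-false (yes a) ¬a = ⊥-elim (¬a a)
⌊⌋-false (no _)  _  = refl

⌊⌋-sound : (a? : Dec A) → ⌊ a? ⌋ ≡ true → A
⌊⌋-sound (yes a) _ = a

not⌊⌋-sound : (a? : Dec A) → not ⌊ a? ⌋ ≡ true → ¬ A
not⌊⌋-sound (no ¬a) _ = ¬a

⌊⌋-⇔ : (a? : Dec A) (b? : Dec B) → (A → B) → (B → A) → ⌊ a? ⌋ ≡ ⌊ b? ⌋
⌊⌋-⇔ (yes _) (yes _) _ _ = refl
⌊⌋-⇔ (yes a) (no ¬b) f _ = ⊥-elim (¬b (f a))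
⌊⌋-⇔ (no ¬a) (yes b) _ g = ⊥-elim (¬a (g b))
⌊⌋-⇔ (no _)  (no _)  _ _ = refl

not-≤? : ∀ m n → not ⌊ m ≤? n ⌋ ≡ ⌊ n <? m ⌋
not-≤? m n with m ≤? n
... | yes m≤n = sym (⌊⌋-false (n <? m) (ℕP.≤⇒≯ m≤n))
... | no  m≰n = sym (⌊⌋-true (n <? m) (ℕP.≰⇒> m≰n))

∧-true⁴ : ∀ {w x y z} → (w ∧ x) ∧ (y ∧ z) ≡ true → w ≡ true × x ≡ true × y ≡ true × z ≡ true
∧-true⁴ {true}  {true}  {true}  {true}  _ = refl , refl , refl , refl
∧-true⁴ {false} ()
∧-true⁴ {true}  {false} ()
∧-true⁴ {true}  {true}  {false} ()
∧-true⁴ {true}  {true}  {true}  {false} ()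

∧-cong-guarded : ∀ {p p' r r'} → p ≡ p' → (p ≡ true → r ≡ r') → p ∧ r ≡ p' ∧ r'
∧-cong-guarded {true}  refl r≡r' = r≡r' refl
∧-cong-guarded {false} refl _    = refl

∑ : (A → ℕ) → List A → ℕ
∑ f xs = sum (map f xs)

𝟙 : Bool → ℕ
𝟙 b = if b then 1 else 0

∑-++ : ∀ (f : A → ℕ) xs ys → ∑ f (xs ++ ys) ≡ ∑ f xs + ∑ f ys
∑-++ f xs ys = trans (cong sum (ListP.map-++ f xs ys)) (sum-++ (map f xs) (map f ys))

∑-cong : ∀ {f g : A → ℕ} xs → (∀ x → f x ≡ g x) → ∑ f xs ≡ ∑ g xs
∑-cong xs f≗g = cong sum (ListP.map-cong f≗g xs)

∑-congᴬ : ∀ {f g : A → ℕ} {xs} → All (λ x → f x ≡ g x) xs → ∑ f xs ≡ ∑ g xs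
∑-congᴬ f≗g = cong sum (ListP.map-cong-local f≗g)

∑-+ : ∀ (f g : A → ℕ) xs → ∑ (λ x → f x + g x) xs ≡ ∑ f xs + ∑ g xs
∑-+ f g []       = refl
∑-+ f g (x ∷ xs) = trans (cong (_+_ (f x + g x)) (∑-+ f g xs)) (+-interchange (f x) (g x) _ _)

∑-zero : ∀ (xs : List A) → ∑ (λ _ → 0) xs ≡ 0
∑-zero []       = refl
∑-zero (_ ∷ xs) = ∑-zero xs

∑-map : ∀ (f : B → ℕ) (g : A → B) xs → ∑ f (map g xs) ≡ ∑ (f ∘ g) xs
∑-map f g xs = cong sum (sym (ListP.map-∘ xs))

∑-concatMap : ∀ (f : B → ℕ) (g : A → List B) xs →
  ∑ f (concatMap g xs) ≡ ∑ (∑ f ∘ g) xs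
∑-concatMap f g []       = refl
∑-concatMap f g (x ∷ xs) =
  trans (∑-++ f (g x) (concatMap g xs)) (cong (_+_ (∑ f (g x))) (∑-concatMap f g xs))

∑-comm : ∀ (h : A → B → ℕ) xs ys →
  ∑ (λ x → ∑ (h x) ys) xs ≡ ∑ (λ y → ∑ (λ x → h x y) xs) ys
∑-comm h []       ys = sym (∑-zero ys)
∑-comm h (x ∷ xs) ys =
  trans (cong (_+_ (∑ (h x) ys)) (∑-comm h xs ys)) (sym (∑-+ (h x) _ ys))

∑-↭ : ∀ (f : A → ℕ) {xs ys} → xs ↭ ys → ∑ f xs ≡ ∑ f ys
∑-↭ f xs↭ys = sum-↭ (map⁺ f xs↭ys)

all-↭ : ∀ (f : A → Bool) {xs ys} → xs ↭ ys → all f xs ≡ all f ys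
all-↭ f xs↭ys = foldr-commMonoid ∧.setoid ∧.isCommutativeMonoid (↭⇒↭ₛ (map⁺ f xs↭ys))
  where module ∧ = CommutativeMonoid ∧-commutativeMonoid

all-++ : ∀ (f : A → Bool) xs ys → all f (xs ++ ys) ≡ all f xs ∧ all f ys
all-++ f []       ys = refl
all-++ f (x ∷ xs) ys = trans (cong (f x ∧_) (all-++ f xs ys)) (sym (∧-assoc (f x) _ _))

all-cong : ∀ {f g : A → Bool} xs → (∀ x → f x ≡ g x) → all f xs ≡ all g xs
all-cong xs f≗g = cong and (ListP.map-cong f≗g xs)

all-map : ∀ (f : B → Bool) (g : A → B) xs → all f (map g xs) ≡ all (f ∘ g) xs
all-map f g xs = cong and (sym (ListP.map-∘ xs))

all-concatMap : ∀ (f : B → Bool) (g : A → List B) xs →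
  all f (concatMap g xs) ≡ all (all f ∘ g) xs
all-concatMap f g []       = refl
all-concatMap f g (x ∷ xs) =
  trans (all-++ f (g x) (concatMap g xs)) (cong (all f (g x) ∧_) (all-concatMap f g xs))

all-∧ : ∀ (f g : A → Bool) xs → all (λ x → f x ∧ g x) xs ≡ all f xs ∧ all g xs
all-∧ f g []       = refl
all-∧ f g (x ∷ xs) = trans (cong ((f x ∧ g x) ∧_) (all-∧ f g xs)) (∧-interchange (f x) (g x) _ _)

all-true : ∀ {f : A → Bool} {xs} → All (λ x → f x ≡ true) xs → all f xs ≡ true
all-true []         = refl
all-true (fx ∷ fxs) rewrite fx = all-true fxs

middle-to-end : ∀ (U M W : List A) → U ++ M ++ W ↭ (U ++ W) ++ M
middle-to-end U M W = ↭-trans (++⁺ˡ U (++-comm M W)) (↭-reflexive (sym (ListP.++-assoc U W M)))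

zip-++ : ∀ (xs xs' : List A) (ys ys' : List B) → length xs ≡ length ys →
  zip (xs ++ xs') (ys ++ ys') ≡ zip xs ys ++ zip xs' ys'
zip-++ []       xs' []       ys' _ = refl
zip-++ (x ∷ xs) xs' (y ∷ ys) ys' e = cong ((x , y) ∷_) (zip-++ xs xs' ys ys' (ℕP.suc-injective e))

All-zip : ∀ {P : A → Set} {xs} (ys : List B) → All P xs → All (P ∘ proj₁) (zip xs ys)
All-zip _        []       = []
All-zip []       (_ ∷ _)  = []
All-zip (_ ∷ ys) (p ∷ ps) = p ∷ All-zip ys ps

weight-↭ : ∀ m {T T'} → T ↭ T' → weight m T ≡ weight m T'
weight-↭ m T↭T' = ListP.map-cong (λ j → ∑-↭ _ T↭T') (upTo m)

countOn : (A × A → Bool) → List A → List A → ℕ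
countOn f X Y = ∑ (λ x → countB (λ y → f (x , y)) Y) X

allOn : (A × A → Bool) → List A → List A → Bool
allOn f X Y = all (λ x → all (λ y → f (x , y)) Y) X

crossCount : (A × A → Bool) → List A → A → ℕ
crossCount f X y = countB (λ x → f (x , y)) X + countB (λ x → f (y , x)) X

countB-pairsOf : ∀ (f : A × A → Bool) X → countB f (pairsOf X) ≡ countOn f X X
countB-pairsOf f X =
  trans (∑-concatMap _ (λ x → map (x ,_) X) X) (∑-cong X (λ x → ∑-map _ (x ,_) X))

all-pairsOf : ∀ (f : A × A → Bool) X → all f (pairsOf X) ≡ allOn f X X
all-pairsOf f X =
  trans (all-concatMap f (λ x → map (x ,_) X) X) (all-cong X (λ x → all-map f (x ,_) X))

countOn-++ˡ : ∀ (f : A × A → Bool) X₁ X₂ Y → countOn f (X₁ ++ X₂) Y ≡ countOn f X₁ Y + countOn f X₂ Y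
countOn-++ˡ f X₁ X₂ Y = ∑-++ _ X₁ X₂

countOn-++ʳ : ∀ (f : A × A → Bool) X Y₁ Y₂ → countOn f X (Y₁ ++ Y₂) ≡ countOn f X Y₁ + countOn f X Y₂
countOn-++ʳ f X Y₁ Y₂ = trans (∑-cong X (λ x → ∑-++ _ Y₁ Y₂)) (∑-+ _ _ X)

countOn-↭ : ∀ (f : A × A → Bool) {X X' Y Y'} → X ↭ X' → Y ↭ Y' → countOn f X Y ≡ countOn f X' Y'
countOn-↭ f {X} X↭X' Y↭Y' = trans (∑-cong X (λ x → ∑-↭ _ Y↭Y')) (∑-↭ _ X↭X')

countOn-++-block : ∀ (f : A × A → Bool) X K →
  countOn f (X ++ K) (X ++ K) ≡ countOn f X X + (∑ (crossCount f X) K + countOn f K K)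
countOn-++-block f X K = begin
  countOn f (X ++ K) (X ++ K)
    ≡⟨ trans (countOn-++ˡ f X K (X ++ K)) (cong₂ _+_ (countOn-++ʳ f X X K) (countOn-++ʳ f K X K)) ⟩
  (countOn f X X + countOn f X K) + (countOn f K X + countOn f K K)
    ≡⟨ cong (λ n → (countOn f X X + n) + (countOn f K X + countOn f K K)) (∑-comm (λ x y → 𝟙 (f (x , y))) X K) ⟩
  (countOn f X X + ∑ (λ y → countB (λ x → f (x , y)) X) K) + (countOn f K X + countOn f K K)
    ≡⟨ rearrange (countOn f X X) (∑ (λ y → countB (λ x → f (x , y)) X) K) (countOn f K X) (countOn f K K) ⟩
  countOn f X X + ((∑ (λ y → countB (λ x → f (x , y)) X) K + countOn f K X) + countOn f K K)
    ≡⟨ cong (λ n → countOn f X X + (n + countOn f K K)) (sym (∑-+ _ _ K)) ⟩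
  countOn f X X + (∑ (crossCount f X) K + countOn f K K) ∎
  where
  open ≡-Reasoning
  rearrange : ∀ a b c e → (a + b) + (c + e) ≡ a + ((b + c) + e)
  rearrange = solve-∀

allOn-++ˡ : ∀ (f : A × A → Bool) X₁ X₂ Y → allOn f (X₁ ++ X₂) Y ≡ allOn f X₁ Y ∧ allOn f X₂ Y
allOn-++ˡ f X₁ X₂ Y = all-++ _ X₁ X₂

allOn-++ʳ : ∀ (f : A × A → Bool) X Y₁ Y₂ → allOn f X (Y₁ ++ Y₂) ≡ allOn f X Y₁ ∧ allOn f X Y₂
allOn-++ʳ f X Y₁ Y₂ = trans (all-cong X (λ x → all-++ _ Y₁ Y₂)) (all-∧ _ _ X)

allOn-↭ : ∀ (f : A × A → Bool) {X X' Y Y'} → X ↭ X' → Y ↭ Y' → allOn f X Y ≡ allOn f X' Y'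
allOn-↭ f {X} X↭X' Y↭Y' = trans (all-cong X (λ x → all-↭ _ Y↭Y')) (all-↭ _ X↭X')

allOn-true : ∀ {f : A × A → Bool} {X Y} → All (λ x → All (λ y → f (x , y) ≡ true) Y) X → allOn f X Y ≡ true
allOn-true = all-true ∘ All.map all-true

allOn-++-independent : ∀ (f : A × A → Bool) X Y → allOn f X Y ≡ true → allOn f Y X ≡ true →
  allOn f (X ++ Y) (X ++ Y) ≡ allOn f X X ∧ allOn f Y Y
allOn-++-independent f X Y XY YX = begin
  allOn f (X ++ Y) (X ++ Y)
    ≡⟨ trans (allOn-++ˡ f X Y (X ++ Y)) (cong₂ _∧_ (allOn-++ʳ f X X Y) (allOn-++ʳ f Y X Y)) ⟩
  (allOn f X X ∧ allOn f X Y) ∧ (allOn f Y X ∧ allOn f Y Y)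
    ≡⟨ cong₂ (λ p q → (allOn f X X ∧ p) ∧ (q ∧ allOn f Y Y)) XY YX ⟩
  (allOn f X X ∧ true) ∧ allOn f Y Y
    ≡⟨ cong (_∧ allOn f Y Y) (∧-identityʳ _) ⟩
  allOn f X X ∧ allOn f Y Y ∎
  where open ≡-Reasoning

letters : ℕ → List ℕ
letters m = applyUpTo suc m

∑-words-suc : ∀ m n (F : List ℕ → ℕ) →
  ∑ F (words m (suc n)) ≡ ∑ (λ v → ∑ (λ t → F (v ∷ t)) (words m n)) (letters m)
∑-words-suc m n F = trans (∑-concatMap F (λ v → map (v ∷_) (words m n)) (letters m))
                          (∑-cong (letters m) (λ v → ∑-map F (v ∷_) (words m n)))

∑-words-+ : ∀ m a b (F : List ℕ → ℕ) →
  ∑ F (words m (a + b)) ≡ ∑ (λ u → ∑ (λ w → F (u ++ w)) (words m b)) (words m a)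
∑-words-+ m zero    b F = sym (ℕP.+-identityʳ _)
∑-words-+ m (suc a) b F = begin
  ∑ F (words m (suc a + b))
    ≡⟨ ∑-words-suc m (a + b) F ⟩
  ∑ (λ v → ∑ (λ t → F (v ∷ t)) (words m (a + b))) (letters m)
    ≡⟨ ∑-cong (letters m) (λ v → ∑-words-+ m a b (λ t → F (v ∷ t))) ⟩
  ∑ (λ v → ∑ (λ u → ∑ (λ w → F (v ∷ u ++ w)) (words m b)) (words m a)) (letters m)
    ≡⟨ sym (∑-words-suc m a (λ u → ∑ (λ w → F (u ++ w)) (words m b))) ⟩
  ∑ (λ u → ∑ (λ w → F (u ++ w)) (words m b)) (words m (suc a)) ∎
  where open ≡-Reasoning

words-length : ∀ m n → All (λ T → length T ≡ n) (words m n)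
words-length m zero    = refl ∷ []
words-length m (suc n) = All.concat⁺ (All.map⁺ (All.universal extend (letters m)))
  where
  extend : ∀ v → All (λ T → length T ≡ suc n) (map (v ∷_) (words m n))
  extend v = All.map⁺ (All.map (cong suc) (words-length m n))

∑⁴ : ℕ → (ℕ → ℕ → ℕ → ℕ → ℕ) → ℕ
∑⁴ m F = ∑ (λ a → ∑ (λ b → ∑ (λ c → ∑ (λ d → F a b c d) L) L) L) L
  where
  L : List ℕ
  L = letters m

∑-words-4 : ∀ m (F : List ℕ → ℕ) → ∑ F (words m 4) ≡ ∑⁴ m (λ a b c d → F (a ∷ b ∷ c ∷ d ∷ []))
∑-words-4 m F = begin
  ∑ F (words m 4)
    ≡⟨ ∑-words-suc m 3 F ⟩
  _ ≡⟨ ∑-cong L (λ a → ∑-words-suc m 2 _) ⟩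
  _ ≡⟨ ∑-cong L (λ a → ∑-cong L (λ b → ∑-words-suc m 1 _)) ⟩
  _ ≡⟨ ∑-cong L (λ a → ∑-cong L (λ b → ∑-cong L (λ c → ∑-words-suc m 0 _))) ⟩
  _ ≡⟨ ∑-cong L (λ a → ∑-cong L (λ b → ∑-cong L (λ c → ∑-cong L (λ d → ℕP.+-identityʳ _)))) ⟩
  ∑⁴ m (λ a b c d → F (a ∷ b ∷ c ∷ d ∷ [])) ∎
  where
  open ≡-Reasoning
  L : List ℕ
  L = letters m

module _ (m : ℕ) where
  private
    L : List ℕ
    L = letters m

  ∑⁴-cong : ∀ {F G} → (∀ a b c d → F a b c d ≡ G a b c d) → ∑⁴ m F ≡ ∑⁴ m G
  ∑⁴-cong F≗G = ∑-cong L λ a → ∑-cong L λ b → ∑-cong L λ c → ∑-cong L λ d → F≗G a b c d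

  ∑⁴-+ : ∀ F G → ∑⁴ m (λ a b c d → F a b c d + G a b c d) ≡ ∑⁴ m F + ∑⁴ m G
  ∑⁴-+ F G = trans
    (∑-cong L λ a → trans
      (∑-cong L λ b → trans
        (∑-cong L λ c → ∑-+ (F a b c) (G a b c) L)
        (∑-+ _ _ L))
      (∑-+ _ _ L))
    (∑-+ _ _ L)

  ∑⁴-+⁴ : ∀ F₁ F₂ F₃ F₄ →
    ∑⁴ m (λ a b c d → F₁ a b c d + (F₂ a b c d + (F₃ a b c d + F₄ a b c d)))
      ≡ ∑⁴ m F₁ + (∑⁴ m F₂ + (∑⁴ m F₃ + ∑⁴ m F₄))
  ∑⁴-+⁴ F₁ F₂ F₃ F₄ =
    trans (∑⁴-+ F₁ _) (cong (_+_ (∑⁴ m F₁)) (trans (∑⁴-+ F₂ _) (cong (_+_ (∑⁴ m F₂)) (∑⁴-+ F₃ F₄))))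

  ∑⁴-swap₁₂ : ∀ F → ∑⁴ m F ≡ ∑⁴ m (λ a b c d → F b a c d)
  ∑⁴-swap₁₂ F = ∑-comm (λ a b → ∑ (λ c → ∑ (F a b c) L) L) L L

  ∑⁴-swap₂₃ : ∀ F → ∑⁴ m F ≡ ∑⁴ m (λ a b c d → F a c b d)
  ∑⁴-swap₂₃ F = ∑-cong L λ a → ∑-comm (λ b c → ∑ (F a b c) L) L L

  ∑⁴-swap₃₄ : ∀ F → ∑⁴ m F ≡ ∑⁴ m (λ a b c d → F a b d c)
  ∑⁴-swap₃₄ F = ∑-cong L λ a → ∑-cong L λ b → ∑-comm (F a b) L L

  ∑⁴-reindex-cdab : ∀ F → ∑⁴ m (λ a b c d → F c d a b) ≡ ∑⁴ m F
  ∑⁴-reindex-cdab F =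
    trans (∑⁴-swap₂₃ _) (trans (∑⁴-swap₁₂ _) (trans (∑⁴-swap₃₄ _) (∑⁴-swap₂₃ _)))

  ∑⁴-reindex-cadb : ∀ F → ∑⁴ m (λ a b c d → F c a d b) ≡ ∑⁴ m F
  ∑⁴-reindex-cadb F = trans (∑⁴-swap₂₃ _) (trans (∑⁴-swap₁₂ _) (∑⁴-swap₃₄ _))

  ∑⁴-reindex-bdac : ∀ F → ∑⁴ m (λ a b c d → F b d a c) ≡ ∑⁴ m F
  ∑⁴-reindex-bdac F = trans (∑⁴-swap₁₂ _) (trans (∑⁴-swap₃₄ _) (∑⁴-swap₂₃ _))

-- v₀ v₁ v₂ v₃ are the letters at shifted contents i, i + 1, d + i, d + i + 1; lo and hi count
-- the inversions with the cells outside the two dominoes, which cannot tell i from i + 1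
-- nor d + i from d + i + 1.
localInv : ℕ → ℕ → ℕ → ℕ → ℕ
localInv v₀ v₁ v₂ v₃ = 𝟙 ⌊ v₁ <? v₀ ⌋ + 𝟙 ⌊ v₂ <? v₁ ⌋ + 𝟙 ⌊ v₃ <? v₂ ⌋

blockStat : (lo hi : ℕ → ℕ) → ℕ → ℕ → ℕ → ℕ → ℕ
blockStat lo hi v₀ v₁ v₂ v₃ = (lo v₀ + lo v₁) + (hi v₂ + hi v₃) + localInv v₀ v₁ v₂ v₃

-- horizontalVertical: a b fill the horizontal domino, c d (top to bottom) the vertical one;
-- verticalHorizontal: a b (top to bottom) fill the vertical domino, c d the horizontal one.
horizontalVertical verticalHorizontal : ℕ → ℕ → ℕ → ℕ → Bool
horizontalVertical a b c d = ⌊ a ≤? b ⌋ ∧ ⌊ c <? d ⌋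
verticalHorizontal a b c d = ⌊ a <? b ⌋ ∧ ⌊ c ≤? d ⌋

localInv-swap-both-≤ : ∀ {a b c d} → d ≤ b → a ≤ c → c < d → localInv a d b c ≡ localInv d a c b
localInv-swap-both-≤ {a} {b} {c} {d} d≤b a≤c c<d
  rewrite ⌊⌋-false (d <? a) (ℕP.<⇒≯ (ℕP.≤-<-trans a≤c c<d))
        | ⌊⌋-false (b <? d) (ℕP.≤⇒≯ d≤b)
        | ⌊⌋-true  (c <? b) (ℕP.<-≤-trans c<d d≤b)
        | ⌊⌋-true  (a <? d) (ℕP.≤-<-trans a≤c c<d)
        | ⌊⌋-false (c <? a) (ℕP.≤⇒≯ a≤c)
        | ⌊⌋-false (b <? c) (ℕP.<⇒≯ (ℕP.<-≤-trans c<d d≤b)) = refl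

localInv-swap-both-> : ∀ {a b c d} → b < d → c < a → a ≤ b → localInv a d b c ≡ localInv d a c b
localInv-swap-both-> {a} {b} {c} {d} b<d c<a a≤b
  rewrite ⌊⌋-false (d <? a) (ℕP.<⇒≯ (ℕP.≤-<-trans a≤b b<d))
        | ⌊⌋-true  (b <? d) b<d
        | ⌊⌋-true  (c <? b) (ℕP.<-≤-trans c<a a≤b)
        | ⌊⌋-true  (a <? d) (ℕP.≤-<-trans a≤b b<d)
        | ⌊⌋-true  (c <? a) c<a
        | ⌊⌋-false (b <? c) (ℕP.<⇒≯ (ℕP.<-≤-trans c<a a≤b)) = refl

localInv-swap-high : ∀ {a b c d} → d ≤ b → c < d → localInv a d b c ≡ localInv a d c b
localInv-swap-high {a} {b} {c} {d} d≤b c<d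
  rewrite ⌊⌋-false (b <? d) (ℕP.≤⇒≯ d≤b)
        | ⌊⌋-true  (c <? b) (ℕP.<-≤-trans c<d d≤b)
        | ⌊⌋-true  (c <? d) c<d
        | ⌊⌋-false (b <? c) (ℕP.<⇒≯ (ℕP.<-≤-trans c<d d≤b)) = shift (𝟙 ⌊ d <? a ⌋)
  where
  shift : ∀ x → x + 0 + 1 ≡ x + 1 + 0
  shift = solve-∀

localInv-swap-low : ∀ {a b c d} → b < d → a ≤ c → c < d → a ≤ b → localInv a d b c ≡ localInv d a b c
localInv-swap-low {a} {b} {c} {d} b<d a≤c c<d a≤b
  rewrite ⌊⌋-false (d <? a) (ℕP.<⇒≯ (ℕP.≤-<-trans a≤c c<d))
        | ⌊⌋-true  (b <? d) b<d
        | ⌊⌋-true  (a <? d) (ℕP.≤-<-trans a≤c c<d)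
        | ⌊⌋-false (b <? a) (ℕP.≤⇒≯ a≤b) = refl

-- The bijection from horizontal-vertical to vertical-horizontal fillings:
-- (a , b , c , d) ↦ (c , a , d , b) if d ≤ b and c < a, (b , d , a , c) if b < d and a ≤ c,
-- and (c , d , a , b) otherwise.  It preserves the multiset of letters, the pairs {v₀ , v₁} and
-- {v₂ , v₃}, and localInv.
module BlockSwap (m : ℕ) (lo hi : ℕ → ℕ) (rest : List ℕ → ℕ → Bool)
                 (rest-↭ : ∀ {xs ys} n → xs ↭ ys → rest xs n ≡ rest ys n) where

  inHV inVH : (Bool → Bool → Bool) → ℕ → ℕ → ℕ → ℕ → ℕ
  inHV g a b c d = 𝟙 ((g ⌊ d ≤? b ⌋ ⌊ a ≤? c ⌋ ∧ horizontalVertical a b c d)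
                      ∧ rest (a ∷ b ∷ c ∷ d ∷ []) (blockStat lo hi a d b c))
  inVH g a b c d = 𝟙 ((g ⌊ b ≤? d ⌋ ⌊ c ≤? a ⌋ ∧ verticalHorizontal a b c d)
                      ∧ rest (a ∷ b ∷ c ∷ d ∷ []) (blockStat lo hi b c a d))

  both first-only second-only neither : Bool → Bool → Bool
  both        x y = x ∧ y
  first-only  x y = x ∧ not y
  second-only x y = not x ∧ y
  neither     x y = not x ∧ not y

  𝟙-cases : ∀ x y s r → 𝟙 (s ∧ r) ≡
    𝟙 ((both x y ∧ s) ∧ r) + (𝟙 ((first-only x y ∧ s) ∧ r)
      + (𝟙 ((second-only x y ∧ s) ∧ r) + 𝟙 ((neither x y ∧ s) ∧ r)))
  𝟙-cases true  true  s r = sym (ℕP.+-identityʳ _)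
  𝟙-cases true  false s r = sym (ℕP.+-identityʳ _)
  𝟙-cases false true  s r = sym (ℕP.+-identityʳ _)
  𝟙-cases false false s r = refl

  rest-cong : ∀ {xs ys n n'} → xs ↭ ys → n ≡ n' → rest xs n ≡ rest ys n'
  rest-cong xs↭ys refl = rest-↭ _ xs↭ys

  swap-both-guard : ∀ (g : Bool → Bool → Bool) a b c d →
    (g ⌊ d ≤? b ⌋ ⌊ a ≤? c ⌋ ∧ horizontalVertical a b c d)
      ≡ (g ⌊ d ≤? b ⌋ ⌊ a ≤? c ⌋ ∧ verticalHorizontal c d a b)
  swap-both-guard g a b c d = cong (g ⌊ d ≤? b ⌋ ⌊ a ≤? c ⌋ ∧_) (∧-comm ⌊ a ≤? b ⌋ ⌊ c <? d ⌋)

  swap-both-stat : ∀ {a b c d} → localInv a d b c ≡ localInv d a c b →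
                   blockStat lo hi a d b c ≡ blockStat lo hi d a c b
  swap-both-stat {a} {b} {c} {d} =
    cong₂ _+_ (cong₂ _+_ (ℕP.+-comm (lo a) (lo d)) (ℕP.+-comm (hi b) (hi c)))

  both-case : ∑⁴ m (inHV both) ≡ ∑⁴ m (inVH both)
  both-case = trans (∑⁴-cong m λ a b c d → cong 𝟙 (∧-cong-guarded (swap-both-guard both a b c d) (λ h →
    let d≤b , a≤c , _ , c<d = ∧-true⁴ {⌊ d ≤? b ⌋} {⌊ a ≤? c ⌋} {⌊ a ≤? b ⌋} {⌊ c <? d ⌋} h in
    rest-cong (++-comm (a ∷ b ∷ []) (c ∷ d ∷ []))
      (swap-both-stat (localInv-swap-both-≤ (⌊⌋-sound (d ≤? b) d≤b) (⌊⌋-sound (a ≤? c) a≤c)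
                                             (⌊⌋-sound (c <? d) c<d))))))
    (∑⁴-reindex-cdab m (inVH both))

  neither-case : ∑⁴ m (inHV neither) ≡ ∑⁴ m (inVH neither)
  neither-case = trans (∑⁴-cong m λ a b c d → cong 𝟙 (∧-cong-guarded (swap-both-guard neither a b c d) (λ h →
    let d≰b , a≰c , a≤b , _ = ∧-true⁴ {not ⌊ d ≤? b ⌋} {not ⌊ a ≤? c ⌋} {⌊ a ≤? b ⌋} {⌊ c <? d ⌋} h in
    rest-cong (++-comm (a ∷ b ∷ []) (c ∷ d ∷ []))
      (swap-both-stat (localInv-swap-both-> (ℕP.≰⇒> (not⌊⌋-sound (d ≤? b) d≰b))
                                             (ℕP.≰⇒> (not⌊⌋-sound (a ≤? c) a≰c))
                                             (⌊⌋-sound (a ≤? b) a≤b))))))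
    (∑⁴-reindex-cdab m (inVH neither))

  first-only-case : ∑⁴ m (inHV first-only) ≡ ∑⁴ m (inVH first-only)
  first-only-case = trans (∑⁴-cong m λ a b c d → cong 𝟙 (∧-cong-guarded (guard a b c d) (λ h →
    let d≤b , _ , _ , c<d = ∧-true⁴ {⌊ d ≤? b ⌋} {not ⌊ a ≤? c ⌋} {⌊ a ≤? b ⌋} {⌊ c <? d ⌋} h in
    rest-cong (↭-trans (prep a (swap b c refl)) (↭-trans (swap a c refl) (prep c (prep a (swap b d refl)))))
      (cong₂ _+_ (cong (_+_ (lo a + lo d)) (ℕP.+-comm (hi b) (hi c)))
                 (localInv-swap-high (⌊⌋-sound (d ≤? b) d≤b) (⌊⌋-sound (c <? d) c<d))))))
    (∑⁴-reindex-cadb m (inVH first-only))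
    where
    guard : ∀ a b c d → (first-only ⌊ d ≤? b ⌋ ⌊ a ≤? c ⌋ ∧ horizontalVertical a b c d)
                      ≡ (first-only ⌊ a ≤? b ⌋ ⌊ d ≤? c ⌋ ∧ verticalHorizontal c a d b)
    guard a b c d rewrite not-≤? a c | not-≤? d c =
      trans (∧-comm (⌊ d ≤? b ⌋ ∧ ⌊ c <? a ⌋) (⌊ a ≤? b ⌋ ∧ ⌊ c <? d ⌋))
            (cong ((⌊ a ≤? b ⌋ ∧ ⌊ c <? d ⌋) ∧_) (∧-comm ⌊ d ≤? b ⌋ ⌊ c <? a ⌋))

  second-only-case : ∑⁴ m (inHV second-only) ≡ ∑⁴ m (inVH second-only)
  second-only-case = trans (∑⁴-cong m λ a b c d → cong 𝟙 (∧-cong-guarded (guard a b c d) (λ h →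
    let d≰b , a≤c , a≤b , c<d = ∧-true⁴ {not ⌊ d ≤? b ⌋} {⌊ a ≤? c ⌋} {⌊ a ≤? b ⌋} {⌊ c <? d ⌋} h in
    rest-cong (↭-trans (swap a b refl) (prep b (↭-trans (prep a (swap c d refl)) (swap a d refl))))
      (cong₂ _+_ (cong (_+ (hi b + hi c)) (ℕP.+-comm (lo a) (lo d)))
                 (localInv-swap-low (ℕP.≰⇒> (not⌊⌋-sound (d ≤? b) d≰b)) (⌊⌋-sound (a ≤? c) a≤c)
                                    (⌊⌋-sound (c <? d) c<d) (⌊⌋-sound (a ≤? b) a≤b))))))
    (∑⁴-reindex-bdac m (inVH second-only))
    where
    guard : ∀ a b c d → (second-only ⌊ d ≤? b ⌋ ⌊ a ≤? c ⌋ ∧ horizontalVertical a b c d)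
                      ≡ (second-only ⌊ d ≤? c ⌋ ⌊ a ≤? b ⌋ ∧ verticalHorizontal b d a c)
    guard a b c d rewrite not-≤? d b | not-≤? d c =
      trans (∧-comm (⌊ b <? d ⌋ ∧ ⌊ a ≤? c ⌋) (⌊ a ≤? b ⌋ ∧ ⌊ c <? d ⌋))
            (cong (_∧ (⌊ b <? d ⌋ ∧ ⌊ a ≤? c ⌋)) (∧-comm ⌊ a ≤? b ⌋ ⌊ c <? d ⌋))

  block-swap :
    ∑⁴ m (λ a b c d → 𝟙 (horizontalVertical a b c d ∧ rest (a ∷ b ∷ c ∷ d ∷ []) (blockStat lo hi a d b c)))
      ≡ ∑⁴ m (λ a b c d → 𝟙 (verticalHorizontal a b c d ∧ rest (a ∷ b ∷ c ∷ d ∷ []) (blockStat lo hi b c a d)))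
  block-swap = begin
    _ ≡⟨ ∑⁴-cong m (λ a b c d → 𝟙-cases ⌊ d ≤? b ⌋ ⌊ a ≤? c ⌋ _ _) ⟩
    _ ≡⟨ ∑⁴-+⁴ m (inHV both) (inHV first-only) (inHV second-only) (inHV neither) ⟩
    _ ≡⟨ cong₂ _+_ both-case (cong₂ _+_ first-only-case (cong₂ _+_ second-only-case neither-case)) ⟩
    _ ≡⟨ sym (∑⁴-+⁴ m (inVH both) (inVH first-only) (inVH second-only) (inVH neither)) ⟩
    _ ≡⟨ sym (∑⁴-cong m (λ a b c d → 𝟙-cases ⌊ b ≤? d ⌋ ⌊ c ≤? a ⌋ _ _)) ⟩
    _ ∎
    where open ≡-Reasoning

-- Shifted contents and inversions

window : ℕ → ℤ → Bool
window d Δ = ⌊ + 0 ℤ.<? Δ ⌋ ∧ ⌊ Δ ℤ.<? + d ⌋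

inWindow : ℕ → ℕ → ℕ → Bool
inWindow d q p = ⌊ q <? p ⌋ ∧ ⌊ p <? d + q ⌋

0<⊖ : ∀ p q → ⌊ + 0 ℤ.<? p ⊖ q ⌋ ≡ ⌊ q <? p ⌋
0<⊖ p q with q <? p
... | yes q<p = ⌊⌋-true (+ 0 ℤ.<? p ⊖ q)
                  (subst (+ 0 ℤ.<_) (sym (ℤP.⊖-≥ (ℕP.<⇒≤ q<p))) (ℤ.+<+ (ℕP.m<n⇒0<n∸m q<p)))
... | no  q≮p = ⌊⌋-false (+ 0 ℤ.<? p ⊖ q) λ 0<p⊖q →
                  ℤP.<⇒≱ 0<p⊖q (subst (ℤ._≤ + 0) (sym (ℤP.⊖-≤ (ℕP.≮⇒≥ q≮p))) ℤP.neg-≤-pos)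

⊖<+ : ∀ d p q → ⌊ p ⊖ q ℤ.<? + d ⌋ ≡ ⌊ p <? d + q ⌋
⊖<+ d p q with q ≤? p
... | yes q≤p rewrite ℤP.⊖-≥ q≤p = ⌊⌋-⇔ (+ (p ℕ.∸ q) ℤ.<? + d) (p <? d + q)
        (λ { (ℤ.+<+ lt) → subst (_< d + q) (ℕP.m∸n+n≡m q≤p) (ℕP.+-monoˡ-< q lt) })
        (λ lt → ℤ.+<+ (ℕP.+-cancelʳ-< _ _ _ (subst (_< d + q) (sym (ℕP.m∸n+n≡m q≤p)) lt)))
... | no  q≰p rewrite ℤP.⊖-< (ℕP.≰⇒> q≰p) =
        trans (negative<+ (ℕP.m<n⇒0<n∸m (ℕP.≰⇒> q≰p)))
              (sym (⌊⌋-true (p <? d + q) (ℕP.<-≤-trans (ℕP.≰⇒> q≰p) (ℕP.m≤n+m q d))))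
  where
  negative<+ : ∀ {x} → 0 < x → ⌊ ℤ.- (+ x) ℤ.<? + d ⌋ ≡ true
  negative<+ {suc x} _ = ⌊⌋-true (ℤ.-[1+ x ] ℤ.<? + d) ℤ.-<+

window-⊖ : ∀ d p q → window d (p ⊖ q) ≡ inWindow d q p
window-⊖ d p q = cong₂ _∧_ (0<⊖ p q) (⊖<+ d p q)

contentInv : ℕ → (ℤ × ℕ) × (ℤ × ℕ) → Bool
contentInv d ((z , a) , (z' , b)) = window d (z' ℤ.- z) ∧ ⌊ b <? a ⌋

contentLabel : ∀ {d} → Labelled {d} → ℤ × ℕ
contentLabel {d} (x , a) = shiftedContent d x , a

invPair≡contentInv : ∀ {d} (x y : Labelled {d}) →
  invPair {d} (x , y) ≡ contentInv d (contentLabel x , contentLabel y)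
invPair≡contentInv {d} (x , a) (y , b) = sym (∧-assoc ⌊ + 0 ℤ.<? Δ ⌋ ⌊ Δ ℤ.<? + d ⌋ ⌊ b <? a ⌋)
  where
  Δ : ℤ
  Δ = shiftedContent d y ℤ.- shiftedContent d x

countOn-invPair : ∀ {d} (X Y : List (Labelled {d})) →
  countOn (invPair {d}) X Y ≡ countOn (contentInv d) (map contentLabel X) (map contentLabel Y)
countOn-invPair {d} X Y = sym (trans (∑-map _ contentLabel X) (∑-cong X λ x →
  trans (∑-map _ contentLabel Y) (∑-cong Y λ y → cong 𝟙 (sym (invPair≡contentInv x y)))))

contentInv-+ : ∀ d q p a b → contentInv d ((+ q , a) , (+ p , b)) ≡ inWindow d q p ∧ ⌊ b <? a ⌋
contentInv-+ d q p a b = cong (_∧ ⌊ b <? a ⌋) (trans (cong (window d) (ℤP.[+m]-[+n]≡m⊖n p q)) (window-⊖ d p q))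

module _ (d : ℕ) {q p : ℕ} (a b : ℕ) where

  contentInv-adjacent : q < p → p < d + q → contentInv d ((+ q , a) , (+ p , b)) ≡ ⌊ b <? a ⌋
  contentInv-adjacent q<p p<d+q
    rewrite contentInv-+ d q p a b | ⌊⌋-true (q <? p) q<p | ⌊⌋-true (p <? d + q) p<d+q = refl

  contentInv-not-after : p ≤ q → contentInv d ((+ q , a) , (+ p , b)) ≡ false
  contentInv-not-after p≤q rewrite contentInv-+ d q p a b | ⌊⌋-false (q <? p) (ℕP.≤⇒≯ p≤q) = refl

  contentInv-too-far : d + q ≤ p → contentInv d ((+ q , a) , (+ p , b)) ≡ false
  contentInv-too-far d+q≤p
    rewrite contentInv-+ d q p a b | ⌊⌋-false (p <? d + q) (ℕP.≤⇒≯ d+q≤p) | ∧-zeroʳ ⌊ q <? p ⌋ = refl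

canonicalBlock : ℕ → ℕ → ℕ → ℕ → ℕ → ℕ → List (ℤ × ℕ)
canonicalBlock d i v₀ v₁ v₂ v₃ =
  (+ i , v₀) ∷ (+ suc i , v₁) ∷ (+ (d + i) , v₂) ∷ (+ (d + suc i) , v₃) ∷ []

countOn-canonicalBlock : ∀ {d} i v₀ v₁ v₂ v₃ → 1 < d →
  countOn (contentInv d) (canonicalBlock d i v₀ v₁ v₂ v₃) (canonicalBlock d i v₀ v₁ v₂ v₃)
    ≡ localInv v₀ v₁ v₂ v₃
countOn-canonicalBlock {d} i v₀ v₁ v₂ v₃ 1<d = computed
  where
  1+i<d+i : suc i < d + i
  1+i<d+i = ℕP.+-monoˡ-< i 1<d
  d+i<d+1+i : d + i < d + suc i
  d+i<d+1+i = ℕP.+-monoʳ-< d (ℕP.n<1+n i)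
  d+i≤d+1+i : d + i ≤ d + suc i
  d+i≤d+1+i = ℕP.<⇒≤ d+i<d+1+i
  K : List (ℤ × ℕ)
  K = canonicalBlock d i v₀ v₁ v₂ v₃
  computed : countOn (contentInv d) K K ≡ localInv v₀ v₁ v₂ v₃
  computed
    rewrite contentInv-not-after d {i} {i} v₀ v₀ ℕP.≤-refl
          | contentInv-adjacent  d {i} {suc i} v₀ v₁ (ℕP.n<1+n i) 1+i<d+i
          | contentInv-too-far   d {i} {d + i} v₀ v₂ ℕP.≤-refl
          | contentInv-too-far   d {i} {d + suc i} v₀ v₃ d+i≤d+1+i
          | contentInv-not-after d {suc i} {i} v₁ v₀ (ℕP.n≤1+n i)
          | contentInv-not-after d {suc i} {suc i} v₁ v₁ ℕP.≤-refl
          | contentInv-adjacent  d {suc i} {d + i} v₁ v₂ 1+i<d+i d+i<d+1+i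
          | contentInv-too-far   d {suc i} {d + suc i} v₁ v₃ ℕP.≤-refl
          | contentInv-not-after d {d + i} {i} v₂ v₀ (ℕP.m≤n+m i d)
          | contentInv-not-after d {d + i} {suc i} v₂ v₁ (ℕP.<⇒≤ 1+i<d+i)
          | contentInv-not-after d {d + i} {d + i} v₂ v₂ ℕP.≤-refl
          | contentInv-adjacent  d {d + i} {d + suc i} v₂ v₃ d+i<d+1+i (ℕP.+-monoʳ-< d 1+i<d+i)
          | contentInv-not-after d {d + suc i} {i} v₃ v₀ (ℕP.≤-trans (ℕP.n≤1+n i) (ℕP.m≤n+m (suc i) d))
          | contentInv-not-after d {d + suc i} {suc i} v₃ v₁ (ℕP.m≤n+m (suc i) d)
          | contentInv-not-after d {d + suc i} {d + i} v₃ v₂ d+i≤d+1+i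
          | contentInv-not-after d {d + suc i} {d + suc i} v₃ v₃ ℕP.≤-refl
    = tidy (𝟙 ⌊ v₁ <? v₀ ⌋) (𝟙 ⌊ v₂ <? v₁ ⌋) (𝟙 ⌊ v₃ <? v₂ ⌋)
    where
    tidy : ∀ x y z → x + 0 + (y + 0 + (z + 0 + 0)) ≡ x + y + z
    tidy = solve-∀

distinct-residues : ∀ {d j k} x y → j ≢ k → j < d → k < d → d * x + j ≢ d * y + k
distinct-residues {d} {j} {k} x y j≢k j<d k<d e = j≢k (begin
  j                ≡⟨ sym (m<n⇒m%n≡m j<d) ⟩
  j % d            ≡⟨ sym ([m+kn]%n≡m%n j x d) ⟩
  (j + x * d) % d  ≡⟨ cong (_% d) (trans (swap-summands j x d) (trans e (sym (swap-summands k y d)))) ⟩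
  (k + y * d) % d  ≡⟨ [m+kn]%n≡m%n k y d ⟩
  k % d            ≡⟨ m<n⇒m%n≡m k<d ⟩
  k                ∎)
  where
  open ≡-Reasoning
  instance
    d≢0 : ℕ.NonZero d
    d≢0 = ℕ.>-nonZero (ℕP.≤-<-trans ℕ.z≤n j<d)
  swap-summands : ∀ j x d → j + x * d ≡ d * x + j
  swap-summands = solve-∀

inWindow-sucʳ : ∀ {d q p} → q ≢ p → suc p ≢ d + q → inWindow d q (suc p) ≡ inWindow d q p
inWindow-sucʳ {d} {q} {p} q≢p 1+p≢d+q = cong₂ _∧_
  (⌊⌋-⇔ (q <? suc p) (q <? p) (λ q<1+p → ℕP.≤∧≢⇒< (ℕP.≤-pred q<1+p) q≢p) ℕP.m<n⇒m<1+n)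
  (⌊⌋-⇔ (suc p <? d + q) (p <? d + q) (ℕP.<-trans (ℕP.n<1+n p)) (λ p<d+q → ℕP.≤∧≢⇒< p<d+q 1+p≢d+q))

inWindow-sucˡ : ∀ {d q p} → suc q ≢ p → p ≢ d + q → inWindow d (suc q) p ≡ inWindow d q p
inWindow-sucˡ {d} {q} {p} 1+q≢p p≢d+q = cong₂ _∧_
  (⌊⌋-⇔ (suc q <? p) (q <? p) (ℕP.<-trans (ℕP.n<1+n q)) (λ q<p → ℕP.≤∧≢⇒< q<p 1+q≢p))
  (⌊⌋-⇔ (p <? d + suc q) (p <? d + q)
        (λ p<d+1+q → ℕP.≤∧≢⇒< (ℕP.≤-pred (subst (p <_) (ℕP.+-suc d q) p<d+1+q)) p≢d+q)
        (λ p<d+q → subst (p <_) (sym (ℕP.+-suc d q)) (ℕP.m<n⇒m<1+n p<d+q)))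

sc-⊖ : ∀ {d} (j : Fin d) r c → shiftedContent d (j , (r , c)) ≡ (d * c + toℕ j) ⊖ (d * r)
sc-⊖ {d} j r c = begin
  + d ℤ.* (+ c ℤ.- + r) ℤ.+ + toℕ j       ≡⟨ distrib (+ d) (+ c) (+ r) (+ toℕ j) ⟩
  + d ℤ.* + c ℤ.+ + toℕ j ℤ.- + d ℤ.* + r
    ≡⟨ cong₂ (λ x y → x ℤ.+ + toℕ j ℤ.- y) (sym (ℤP.pos-* d c)) (sym (ℤP.pos-* d r)) ⟩
  + (d * c) ℤ.+ + toℕ j ℤ.- + (d * r)      ≡⟨ cong (ℤ._- + (d * r)) (sym (ℤP.pos-+ (d * c) (toℕ j))) ⟩
  + (d * c + toℕ j) ℤ.- + (d * r)          ≡⟨ ℤP.[+m]-[+n]≡m⊖n (d * c + toℕ j) (d * r) ⟩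
  (d * c + toℕ j) ⊖ (d * r)                ∎
  where
  open ≡-Reasoning
  distrib : ∀ (D C R J : ℤ) → D ℤ.* (C ℤ.- R) ℤ.+ J ≡ D ℤ.* C ℤ.+ J ℤ.- D ℤ.* R
  distrib = ℤSolver.solve-∀

+-minus-⊖ : ∀ p q₁ q₂ → + p ℤ.- (q₁ ⊖ q₂) ≡ (p + q₂) ⊖ q₁
+-minus-⊖ p q₁ q₂ = begin
  + p ℤ.- (q₁ ⊖ q₂)            ≡⟨ cong (λ x → + p ℤ.- x) (sym (ℤP.[+m]-[+n]≡m⊖n q₁ q₂)) ⟩
  + p ℤ.- (+ q₁ ℤ.- + q₂)      ≡⟨ regroup (+ p) (+ q₁) (+ q₂) ⟩
  (+ p ℤ.+ + q₂) ℤ.- + q₁      ≡⟨ cong (ℤ._- + q₁) (sym (ℤP.pos-+ p q₂)) ⟩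
  + (p + q₂) ℤ.- + q₁          ≡⟨ ℤP.[+m]-[+n]≡m⊖n (p + q₂) q₁ ⟩
  (p + q₂) ⊖ q₁                ∎
  where
  open ≡-Reasoning
  regroup : ∀ (P Q₁ Q₂ : ℤ) → P ℤ.- (Q₁ ℤ.- Q₂) ≡ (P ℤ.+ Q₂) ℤ.- Q₁
  regroup = ℤSolver.solve-∀

⊖-minus-+ : ∀ q₁ q₂ p → (q₁ ⊖ q₂) ℤ.- + p ≡ q₁ ⊖ (q₂ + p)
⊖-minus-+ q₁ q₂ p = begin
  (q₁ ⊖ q₂) ℤ.- + p            ≡⟨ cong (ℤ._- + p) (sym (ℤP.[+m]-[+n]≡m⊖n q₁ q₂)) ⟩
  (+ q₁ ℤ.- + q₂) ℤ.- + p      ≡⟨ regroup (+ q₁) (+ q₂) (+ p) ⟩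
  + q₁ ℤ.- (+ q₂ ℤ.+ + p)      ≡⟨ cong (λ x → + q₁ ℤ.- x) (sym (ℤP.pos-+ q₂ p)) ⟩
  + q₁ ℤ.- + (q₂ + p)          ≡⟨ ℤP.[+m]-[+n]≡m⊖n q₁ (q₂ + p) ⟩
  q₁ ⊖ (q₂ + p)                ∎
  where
  open ≡-Reasoning
  regroup : ∀ (Q₁ Q₂ P : ℤ) → (Q₁ ℤ.- Q₂) ℤ.- P ≡ Q₁ ℤ.- (Q₂ ℤ.+ P)
  regroup = ℤSolver.solve-∀

sc-diagonal : ∀ {d} (j : Fin d) r → shiftedContent d (j , (r , r)) ≡ + toℕ j
sc-diagonal {d} j r = cancel (+ d) (+ r) (+ toℕ j)
  where
  cancel : ∀ (D R J : ℤ) → D ℤ.* (R ℤ.- R) ℤ.+ J ≡ J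
  cancel = ℤSolver.solve-∀

sc-superdiagonal : ∀ {d} (j : Fin d) r → shiftedContent d (j , (r , suc r)) ≡ + (d + toℕ j)
sc-superdiagonal {d} j r = begin
  + d ℤ.* (+ suc r ℤ.- + r) ℤ.+ + toℕ j        ≡⟨ cong (λ x → + d ℤ.* (x ℤ.- + r) ℤ.+ + toℕ j) (ℤP.pos-+ 1 r) ⟩
  + d ℤ.* (+ 1 ℤ.+ + r ℤ.- + r) ℤ.+ + toℕ j    ≡⟨ cancel (+ d) (+ r) (+ toℕ j) ⟩
  + d ℤ.+ + toℕ j                              ≡⟨ sym (ℤP.pos-+ d (toℕ j)) ⟩
  + (d + toℕ j)                                ∎
  where
  open ≡-Reasoning
  cancel : ∀ (D R J : ℤ) → D ℤ.* (ℤ.+ 1 ℤ.+ R ℤ.- R) ℤ.+ J ≡ D ℤ.+ J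
  cancel = ℤSolver.solve-∀

-- z cannot tell the shifted contents p and p + 1 apart
Blind : ℕ → ℕ → ℤ → Set
Blind d p z = (window d (+ suc p ℤ.- z) ≡ window d (+ p ℤ.- z))
            × (window d (z ℤ.- + suc p) ≡ window d (z ℤ.- + p))

-- p − z and p + 1 − z can only differ in lying in (0 , d) when z ≡ p or z ≡ p + 1 (mod d).
external-blind : ∀ {d i} (j : Fin d) r c t → suc i < d → toℕ j ≢ i → toℕ j ≢ suc i →
  Blind d (d * t + i) (shiftedContent d (j , (r , c)))
external-blind {d} {i} j r c t 1+i<d j≢i j≢1+i rewrite sc-⊖ j r c =
    trans (window-of (+-minus-⊖ (suc p) q₁ q₂))
   (trans (inWindow-sucʳ {d} q₁≢p+q₂ 1+p+q₂≢d+q₁)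
          (sym (window-of (+-minus-⊖ p q₁ q₂))))
  , trans (window-of (trans (⊖-minus-+ q₁ q₂ (suc p)) (cong (q₁ ⊖_) (ℕP.+-suc q₂ p))))
   (trans (inWindow-sucˡ {d} 1+q₂+p≢q₁ q₁≢d+q₂+p)
          (sym (window-of (⊖-minus-+ q₁ q₂ p))))
  where
  p q₁ q₂ : ℕ
  p  = d * t + i
  q₁ = d * c + toℕ j
  q₂ = d * r
  window-of : ∀ {Δ x y} → Δ ≡ x ⊖ y → window d Δ ≡ inWindow d y x
  window-of {x = x} {y} Δ≡x⊖y = trans (cong (window d) Δ≡x⊖y) (window-⊖ d x y)
  j<d : toℕ j < d
  j<d = FinP.toℕ<n j
  i<d : i < d
  i<d = ℕP.<-trans (ℕP.n<1+n i) 1+i<d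
  q₁≢p+q₂ : q₁ ≢ p + q₂
  q₁≢p+q₂ e = distinct-residues c (t + r) j≢i j<d i<d (trans e (nf d t i r))
    where
    nf : ∀ d t i r → d * t + i + d * r ≡ d * (t + r) + i
    nf = solve-∀
  1+p+q₂≢d+q₁ : suc (p + q₂) ≢ d + q₁
  1+p+q₂≢d+q₁ e = distinct-residues (suc c) (t + r) j≢1+i j<d 1+i<d
                    (trans (nf₁ d c (toℕ j)) (trans (sym e) (nf₂ d t i r)))
    where
    nf₁ : ∀ d c j → d * suc c + j ≡ d + (d * c + j)
    nf₁ = solve-∀
    nf₂ : ∀ d t i r → suc (d * t + i + d * r) ≡ d * (t + r) + suc i
    nf₂ = solve-∀
  1+q₂+p≢q₁ : suc (q₂ + p) ≢ q₁
  1+q₂+p≢q₁ e = distinct-residues c (r + t) j≢1+i j<d 1+i<d (trans (sym e) (nf d r t i))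
    where
    nf : ∀ d r t i → suc (d * r + (d * t + i)) ≡ d * (r + t) + suc i
    nf = solve-∀
  q₁≢d+q₂+p : q₁ ≢ d + (q₂ + p)
  q₁≢d+q₂+p e = distinct-residues c (suc (r + t)) j≢i j<d i<d (trans e (nf d r t i))
    where
    nf : ∀ d r t i → d + (d * r + (d * t + i)) ≡ d * suc (r + t) + i
    nf = solve-∀

crossCount-blind : ∀ {d p} (X : List (ℤ × ℕ)) v → All (Blind d p ∘ proj₁) X →
  crossCount (contentInv d) X (+ suc p , v) ≡ crossCount (contentInv d) X (+ p , v)
crossCount-blind X v blind = cong₂ _+_
  (∑-congᴬ (All.map (λ {x} b → cong (λ w → 𝟙 (w ∧ ⌊ v <? proj₂ x ⌋)) (proj₁ b)) blind))
  (∑-congᴬ (All.map (λ {x} b → cong (λ w → 𝟙 (w ∧ ⌊ proj₂ x <? v ⌋)) (proj₂ b)) blind))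

relabel : ∀ {z₀ z₁ z₂ z₃ z₀' z₁' z₂' z₃' : ℤ} {a b c e : ℕ} →
  z₀ ≡ z₀' → z₁ ≡ z₁' → z₂ ≡ z₂' → z₃ ≡ z₃' →
  _≡_ {A = List (ℤ × ℕ)} ((z₀ , a) ∷ (z₁ , b) ∷ (z₂ , c) ∷ (z₃ , e) ∷ [])
                         ((z₀' , a) ∷ (z₁' , b) ∷ (z₂' , c) ∷ (z₃' , e) ∷ [])
relabel refl refl refl refl = refl

module _ {d : ℕ} where

  ssPair-distinct : ∀ (x y : Labelled {d}) → proj₁ (proj₁ x) ≢ proj₁ (proj₁ y) → ssPair {d} (x , y) ≡ true
  ssPair-distinct ((j , _) , _) ((j' , _) , _) j≢j' rewrite ⌊⌋-false (j Fin.≟ j') j≢j' = refl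

  ssPair-refl : ∀ (j : Fin d) r c a → ssPair {d} (((j , (r , c)) , a) , ((j , (r , c)) , a)) ≡ true
  ssPair-refl j r c a rewrite ⌊⌋-true (j Fin.≟ j) refl | ⌊⌋-true (r ℕ.≟ r) refl | ⌊⌋-true (c ℕ.≟ c) refl
    | ⌊⌋-false (r <? r) (ℕP.<-irrefl refl) | ⌊⌋-false (c <? c) (ℕP.<-irrefl refl) = refl

  ssPair-rightwards : ∀ (j : Fin d) r c a b →
    ssPair {d} (((j , (r , c)) , a) , ((j , (r , suc c)) , b)) ≡ ⌊ a ≤? b ⌋
  ssPair-rightwards j r c a b rewrite ⌊⌋-true (j Fin.≟ j) refl | ⌊⌋-true (r ℕ.≟ r) refl
    | ⌊⌋-true (c <? suc c) (ℕP.n<1+n c) | ⌊⌋-false (c ℕ.≟ suc c) (ℕP.1+n≢n ∘ sym) = ∧-identityʳ _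

  ssPair-leftwards : ∀ (j : Fin d) r c a b →
    ssPair {d} (((j , (r , suc c)) , a) , ((j , (r , c)) , b)) ≡ true
  ssPair-leftwards j r c a b rewrite ⌊⌋-true (j Fin.≟ j) refl | ⌊⌋-true (r ℕ.≟ r) refl
    | ⌊⌋-false (suc c <? c) (ℕP.<⇒≯ (ℕP.n<1+n c)) | ⌊⌋-false (suc c ℕ.≟ c) (ℕP.1+n≢n) = refl

  ssPair-downwards : ∀ (j : Fin d) r c a b →
    ssPair {d} (((j , (r , c)) , a) , ((j , (suc r , c)) , b)) ≡ ⌊ a <? b ⌋
  ssPair-downwards j r c a b rewrite ⌊⌋-true (j Fin.≟ j) refl | ⌊⌋-true (c ℕ.≟ c) refl
    | ⌊⌋-true (r <? suc r) (ℕP.n<1+n r) | ⌊⌋-false (r ℕ.≟ suc r) (ℕP.1+n≢n ∘ sym) = refl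

  ssPair-upwards : ∀ (j : Fin d) r c a b →
    ssPair {d} (((j , (suc r , c)) , a) , ((j , (r , c)) , b)) ≡ true
  ssPair-upwards j r c a b rewrite ⌊⌋-true (j Fin.≟ j) refl | ⌊⌋-true (c ℕ.≟ c) refl
    | ⌊⌋-false (suc r <? r) (ℕP.<⇒≯ (ℕP.n<1+n r)) | ⌊⌋-false (suc r ℕ.≟ r) (ℕP.1+n≢n) = refl

allOn-pair : ∀ (f : A × A → Bool) x y →
  allOn f (x ∷ y ∷ []) (x ∷ y ∷ []) ≡ (f (x , x) ∧ f (x , y)) ∧ (f (y , x) ∧ f (y , y))
allOn-pair f x y
  rewrite ∧-identityʳ (f (x , y)) | ∧-identityʳ (f (y , y)) | ∧-identityʳ (f (y , x) ∧ f (y , y)) = refl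

module _ {d : ℕ} where

  horizontalDomino verticalDomino : Fin d → ℕ → List (TCell d)
  horizontalDomino j r = (j , (r , r)) ∷ (j , (r , suc r)) ∷ []
  verticalDomino   j s = (j , (s , suc s)) ∷ (j , (suc s , suc s)) ∷ []

  allOn-horizontalDomino : ∀ (j : Fin d) r a b →
    allOn (ssPair {d}) (zip (horizontalDomino j r) (a ∷ b ∷ [])) (zip (horizontalDomino j r) (a ∷ b ∷ []))
      ≡ ⌊ a ≤? b ⌋
  allOn-horizontalDomino j r a b
    rewrite allOn-pair (ssPair {d}) ((j , (r , r)) , a) ((j , (r , suc r)) , b)
          | ssPair-refl j r r a | ssPair-rightwards j r r a b
          | ssPair-leftwards j r r b a | ssPair-refl j r (suc r) b = ∧-identityʳ _

  allOn-verticalDomino : ∀ (j : Fin d) s a b →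
    allOn (ssPair {d}) (zip (verticalDomino j s) (a ∷ b ∷ [])) (zip (verticalDomino j s) (a ∷ b ∷ []))
      ≡ ⌊ a <? b ⌋
  allOn-verticalDomino j s a b
    rewrite allOn-pair (ssPair {d}) ((j , (s , suc s)) , a) ((j , (suc s , suc s)) , b)
          | ssPair-refl j s (suc s) a | ssPair-downwards j s (suc s) a b
          | ssPair-upwards j s (suc s) b a | ssPair-refl j (suc s) (suc s) b = ∧-identityʳ _

allOn-ssPair-apart : ∀ {d} (M M' : List (Labelled {d})) →
  All (λ x → All (λ y → proj₁ (proj₁ x) ≢ proj₁ (proj₁ y)) M') M → allOn (ssPair {d}) M M' ≡ true
allOn-ssPair-apart M M' = allOn-true ∘ All.map (λ {x} → All.map (λ {y} → ssPair-distinct x y))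

allOn-ssPair-components : ∀ {d} {j j' : Fin d} (M M' : List (Labelled {d})) → j ≢ j' →
  All ((_≡ j) ∘ proj₁ ∘ proj₁) M → All ((_≡ j') ∘ proj₁ ∘ proj₁) M' →
  allOn (ssPair {d}) (M ++ M') (M ++ M') ≡ allOn (ssPair {d}) M M ∧ allOn (ssPair {d}) M' M'
allOn-ssPair-components M M' j≢j' inM inM' = allOn-++-independent ssPair M M'
  (allOn-ssPair-apart M M' (All.map (λ x≡j → All.map (λ y≡j' x≡y →
     j≢j' (trans (sym x≡j) (trans x≡y y≡j'))) inM') inM))
  (allOn-ssPair-apart M' M (All.map (λ y≡j' → All.map (λ x≡j y≡x →
     j≢j' (trans (sym x≡j) (trans (sym y≡x) y≡j'))) inM) inM'))

_<ₗₑₓ_ : Cell → Cell → Set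
_<ₗₑₓ_ = ×-Lex _≡_ _<_ _<_

<ₗₑₓ-asym : Asymmetric _<ₗₑₓ_
<ₗₑₓ-asym = ×-asymmetric {_≈₁_ = _≡_} {_<₁_ = _<_} {_<₂_ = _<_} sym (resp₂ _<_) ℕP.<-asym ℕP.<-asym

cells-sorted : ∀ s → AllPairs _<ₗₑₓ_ (cells s)
cells-sorted s = AllPairs.concat⁺ (All.map⁺ (All.universal row-sorted (upTo (length (outer s)))))
                                  (AllPairs.map⁺ (AllPairs.applyUpTo⁺₁ id (length (outer s)) rows-ordered))
  where
  row : ℕ → List Cell
  row r = map (r ,_) (applyUpTo (λ c → part (inner s) r + c) (part (outer s) r ℕ.∸ part (inner s) r))
  row-sorted : ∀ r → AllPairs _<ₗₑₓ_ (row r)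
  row-sorted r = AllPairs.map⁺ (AllPairs.applyUpTo⁺₁ _ _ (λ c<c' _ → inj₂ (refl , ℕP.+-monoʳ-< _ c<c')))
  rows-ordered : ∀ {r r'} → r < r' → r' < length (outer s) → All (λ x → All (x <ₗₑₓ_) (row r')) (row r)
  rows-ordered r<r' _ = All.map⁺ (All.universal (λ _ → All.map⁺ (All.universal (λ _ → inj₁ r<r') _)) _)

module _ {_≺_ : A → A → Set} (≺-asym : Asymmetric _≺_) where

  private
    ≺-irrefl : ∀ {x} → ¬ (x ≺ x)
    ≺-irrefl x≺x = ≺-asym x≺x x≺x

  sorted-singleton : ∀ {p q xs} → All (p ≺_) xs → AllPairs _≺_ xs →
    (∀ {y} → y ∈ xs → y ≡ p ⊎ y ≡ q) → q ∈ xs → xs ≡ q ∷ []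
  sorted-singleton {xs = y ∷ ys} (p≺y ∷ _) (y≺ys ∷ _) only _ with only (here refl)
  ... | inj₁ refl = ⊥-elim (≺-irrefl p≺y)
  sorted-singleton {xs = _ ∷ []}    _ _ _ _ | inj₂ refl = refl
  sorted-singleton {xs = _ ∷ z ∷ _} (_ ∷ p≺z ∷ _) ((q≺z ∷ _) ∷ _) only _ | inj₂ refl
    with only (there (here refl))
  ... | inj₁ refl = ⊥-elim (≺-irrefl p≺z)
  ... | inj₂ refl = ⊥-elim (≺-irrefl q≺z)

  sorted-pair : ∀ {p q xs} → p ≺ q → AllPairs _≺_ xs → (∀ x → (x ∈ xs) ⇔ (x ≡ p ⊎ x ≡ q)) →
    xs ≡ p ∷ q ∷ []
  sorted-pair {p} {xs = []} _ _ members with Equivalence.from (members p) (inj₁ refl)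
  ... | ()
  sorted-pair {p} {q} {x ∷ xs} p≺q (x≺xs ∷ sorted) members with Equivalence.from (members p) (inj₁ refl)
  ... | here refl =
    cong (p ∷_) (sorted-singleton x≺xs sorted (λ y∈xs → Equivalence.to (members _) (there y∈xs))
                  (q∈xs (Equivalence.from (members q) (inj₂ refl))))
    where
    q∈xs : q ∈ p ∷ xs → q ∈ xs
    q∈xs (here q≡p)  = ⊥-elim (≺-irrefl (subst (p ≺_) q≡p p≺q))
    q∈xs (there q∈) = q∈
  ... | there p∈xs with Equivalence.to (members x) (here refl)
  ...   | inj₁ refl = ⊥-elim (≺-irrefl (All.lookup x≺xs p∈xs))
  ...   | inj₂ refl = ⊥-elim (≺-asym p≺q (All.lookup x≺xs p∈xs))

cells-horizontal : ∀ s (hd : IsHorizontalDomino01 s) →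
  cells s ≡ (proj₁ hd , proj₁ hd) ∷ (proj₁ hd , suc (proj₁ hd)) ∷ []
cells-horizontal s (r , members) = sorted-pair <ₗₑₓ-asym (inj₂ (refl , ℕP.n<1+n r)) (cells-sorted s) members

cells-vertical : ∀ s (vd : IsVerticalDomino01 s) →
  cells s ≡ (proj₁ vd , suc (proj₁ vd)) ∷ (suc (proj₁ vd) , suc (proj₁ vd)) ∷ []
cells-vertical s (r , members) = sorted-pair <ₗₑₓ-asym (inj₁ (ℕP.n<1+n r)) (cells-sorted s) members

record Around (n k : ℕ) : Set where
  field
    before after : List (Fin n)
    left right   : Fin n
    allFin≡      : allFin n ≡ before ++ left ∷ right ∷ after
    toℕ-left     : toℕ left ≡ k
    toℕ-right    : toℕ right ≡ suc k
    before<k     : All (λ j → toℕ j < k) before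
    after>1+k    : All (λ j → suc k < toℕ j) after

allFin-suc : ∀ n → allFin (suc n) ≡ Fin.zero ∷ map Fin.suc (allFin n)
allFin-suc n = cong (Fin.zero ∷_) (sym (ListP.map-tabulate id Fin.suc))

around : ∀ n k → suc k < n → Around n k
around (suc (suc n)) zero _ = record
  { before    = []
  ; after     = map Fin.suc (map Fin.suc (allFin n))
  ; left      = Fin.zero
  ; right     = Fin.suc Fin.zero
  ; allFin≡   = trans (allFin-suc (suc n)) (cong (λ js → Fin.zero ∷ map Fin.suc js) (allFin-suc n))
  ; toℕ-left  = refl
  ; toℕ-right = refl
  ; before<k  = []
  ; after>1+k = All.map⁺ (All.map⁺ (All.universal (λ _ → ℕ.s≤s (ℕ.s≤s ℕ.z≤n)) (allFin n)))
  }
around (suc n) (suc k) (ℕ.s≤s 1+k<n) = record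
  { before    = Fin.zero ∷ map Fin.suc A.before
  ; after     = map Fin.suc A.after
  ; left      = Fin.suc A.left
  ; right     = Fin.suc A.right
  ; allFin≡   = trans (allFin-suc n) (cong (Fin.zero ∷_)
                  (trans (cong (map Fin.suc) A.allFin≡) (ListP.map-++ Fin.suc A.before _)))
  ; toℕ-left  = cong suc A.toℕ-left
  ; toℕ-right = cong suc A.toℕ-right
  ; before<k  = ℕ.s≤s ℕ.z≤n ∷ All.map⁺ (All.map ℕ.s≤s A.before<k)
  ; after>1+k = All.map⁺ (All.map ℕ.s≤s A.after>1+k)
  }
  where module A = Around (around n k 1+k<n)

module _ {d : ℕ} (a b : Fin d) (lam : Tuple d) where

  swapTuple-left : swapTuple a b lam a ≡ lam b
  swapTuple-left rewrite ⌊⌋-true (a Fin.≟ a) refl = refl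

  swapTuple-right : a ≢ b → swapTuple a b lam b ≡ lam a
  swapTuple-right a≢b rewrite ⌊⌋-false (b Fin.≟ a) (a≢b ∘ sym) | ⌊⌋-true (b Fin.≟ b) refl = refl

  swapTuple-other : ∀ {j} → j ≢ a → j ≢ b → swapTuple a b lam j ≡ lam j
  swapTuple-other {j} j≢a j≢b rewrite ⌊⌋-false (j Fin.≟ a) j≢a | ⌊⌋-false (j Fin.≟ b) j≢b = refl

tagged : ∀ {d} → Tuple d → Fin d → List (TCell d)
tagged lam j = map (j ,_) (cells (lam j))

All-tagged : ∀ {d} {Q : Fin d → Set} (lam : Tuple d) {js} →
  All Q js → All (Q ∘ proj₁) (concatMap (tagged lam) js)
All-tagged lam = All.concat⁺ ∘ All.map⁺ ∘ All.map (λ q → All.map⁺ (All.universal (λ _ → q) _))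

-- Swapping the two dominoes

module DominoSwap (d i : ℕ) (1+i<d : suc i < d) (α : List ℕ) (k : ℕ) where

  I J : Fin d
  I = posI i 1+i<d
  J = posI+1 i 1+i<d

  toℕ-I : toℕ I ≡ i
  toℕ-I = FinP.toℕ-fromℕ< _

  toℕ-J : toℕ J ≡ suc i
  toℕ-J = FinP.toℕ-fromℕ< _

  I≢J : I ≢ J
  I≢J I≡J = ℕP.1+n≢n (trans (sym toℕ-J) (trans (cong toℕ (sym I≡J)) toℕ-I))

  1<d : 1 < d
  1<d = ℕP.≤-<-trans (ℕ.s≤s ℕ.z≤n) 1+i<d

  m : ℕ
  m = length α

  -- coeffG lam α k unfolds to fillingCount (allCells lam)
  fillingOK : List (TCell d) → List ℕ → Bool
  fillingOK L T = all (ssPair {d}) (pairsOf (zip L T)) ∧ ⌊ ≡-dec ℕ._≟_ (weight m T) α ⌋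
                ∧ ⌊ countB (invPair {d}) (pairsOf (zip L T)) ℕ.≟ k ⌋

  fillingCount : List (TCell d) → ℕ
  fillingCount L = countB (fillingOK L) (words m (length L))

  blockHV blockVH : ℕ → ℕ → List (TCell d)
  blockHV r s = horizontalDomino I r ++ verticalDomino J s
  blockVH r s = verticalDomino I s ++ horizontalDomino J r

  Outside : Fin d → Set
  Outside j = toℕ j ≢ i × toℕ j ≢ suc i

  External InBlock : TCell d → Set
  External (j , _) = Outside j
  InBlock  (j , _) = j ≡ I ⊎ j ≡ J

  external≢block : ∀ {x y} → External x → InBlock y → proj₁ x ≢ proj₁ y
  external≢block (j≢i , _)   (inj₁ refl) j≡I = j≢i   (trans (cong toℕ j≡I) toℕ-I)
  external≢block (_ , j≢1+i) (inj₂ refl) j≡J = j≢1+i (trans (cong toℕ j≡J) toℕ-J)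

  external-blind-block : ∀ {x} → External x →
    Blind d i (shiftedContent d x) × Blind d (d + i) (shiftedContent d x)
  external-blind-block {j , (r , c)} (j≢i , j≢1+i) =
      subst (λ p → Blind d p (shiftedContent d (j , (r , c)))) (cong (_+ i) (ℕP.*-zeroʳ d))
            (external-blind j r c 0 1+i<d j≢i j≢1+i)
    , subst (λ p → Blind d p (shiftedContent d (j , (r , c)))) (cong (_+ i) (ℕP.*-identityʳ d))
            (external-blind j r c 1 1+i<d j≢i j≢1+i)

  sc-I-diagonal : ∀ r → shiftedContent d (I , (r , r)) ≡ + i
  sc-I-diagonal r = trans (sc-diagonal I r) (cong +_ toℕ-I)

  sc-J-diagonal : ∀ r → shiftedContent d (J , (r , r)) ≡ + suc i
  sc-J-diagonal r = trans (sc-diagonal J r) (cong +_ toℕ-J)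

  sc-I-superdiagonal : ∀ r → shiftedContent d (I , (r , suc r)) ≡ + (d + i)
  sc-I-superdiagonal r = trans (sc-superdiagonal I r) (cong (λ n → + (d + n)) toℕ-I)

  sc-J-superdiagonal : ∀ r → shiftedContent d (J , (r , suc r)) ≡ + (d + suc i)
  sc-J-superdiagonal r = trans (sc-superdiagonal J r) (cong (λ n → + (d + n)) toℕ-J)

  module Fiber (P Q : List (TCell d)) (extP : All External P) (extQ : All External Q)
               (u w : List ℕ) (|P|≡|u| : length P ≡ length u) where

    U W X : List (Labelled {d})
    U = zip P u
    W = zip Q w
    X = U ++ W

    Xs : List (ℤ × ℕ)
    Xs = map contentLabel X

    extX : All (External ∘ proj₁) X
    extX = All.++⁺ (All-zip u extP) (All-zip w extQ)

    lo hi : ℕ → ℕ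
    lo v = crossCount (contentInv d) Xs (+ i , v)
    hi v = crossCount (contentInv d) Xs (+ (d + i) , v)

    rest : List ℕ → ℕ → Bool
    rest vs n = allOn (ssPair {d}) X X ∧ ⌊ ≡-dec ℕ._≟_ (weight m (u ++ vs ++ w)) α ⌋
              ∧ ⌊ countOn (contentInv d) Xs Xs + n ℕ.≟ k ⌋

    rest-↭ : ∀ {xs ys} n → xs ↭ ys → rest xs n ≡ rest ys n
    rest-↭ n xs↭ys =
      cong (λ T → allOn (ssPair {d}) X X ∧ ⌊ ≡-dec ℕ._≟_ T α ⌋ ∧ ⌊ countOn (contentInv d) Xs Xs + n ℕ.≟ k ⌋)
           (weight-↭ m (++⁺ˡ u (++⁺ʳ w xs↭ys)))

    crossCount-block : ∀ v₀ v₁ v₂ v₃ →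
      ∑ (crossCount (contentInv d) Xs) (canonicalBlock d i v₀ v₁ v₂ v₃) ≡ (lo v₀ + lo v₁) + (hi v₂ + hi v₃)
    crossCount-block v₀ v₁ v₂ v₃ =
      trans (cong₂ (λ x y → lo v₀ + (x + (hi v₂ + (y + 0)))) lo-v₁ hi-v₃)
            (regroup (lo v₀) (lo v₁) (hi v₂) (hi v₃))
      where
      blind : All (λ y → Blind d i (proj₁ y) × Blind d (d + i) (proj₁ y)) Xs
      blind = All.map⁺ (All.map (λ {x} → external-blind-block {proj₁ x}) extX)
      lo-v₁ : crossCount (contentInv d) Xs (+ suc i , v₁) ≡ lo v₁
      lo-v₁ = crossCount-blind Xs v₁ (All.map proj₁ blind)
      hi-v₃ : crossCount (contentInv d) Xs (+ (d + suc i) , v₃) ≡ hi v₃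
      hi-v₃ = trans (cong (λ n → crossCount (contentInv d) Xs (+ n , v₃)) (ℕP.+-suc d i))
                    (crossCount-blind Xs v₃ (All.map proj₂ blind))
      regroup : ∀ a b c e → a + (b + (c + (e + 0))) ≡ (a + b) + (c + e)
      regroup = solve-∀

    semistandard-split : ∀ M → All (InBlock ∘ proj₁) M →
      all (ssPair {d}) (pairsOf (U ++ M ++ W)) ≡ allOn (ssPair {d}) X X ∧ allOn (ssPair {d}) M M
    semistandard-split M inM = begin
      all (ssPair {d}) (pairsOf (U ++ M ++ W))
        ≡⟨ all-pairsOf (ssPair {d}) (U ++ M ++ W) ⟩
      allOn (ssPair {d}) (U ++ M ++ W) (U ++ M ++ W)
        ≡⟨ allOn-↭ (ssPair {d}) (middle-to-end U M W) (middle-to-end U M W) ⟩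
      allOn (ssPair {d}) (X ++ M) (X ++ M)
        ≡⟨ allOn-++-independent (ssPair {d}) X M
             (allOn-ssPair-apart X M (All.map (λ {x} ex → All.map (λ {y} →
                external≢block {proj₁ x} {proj₁ y} ex) inM) extX))
             (allOn-ssPair-apart M X (All.map (λ {y} inb → All.map (λ {x} ex →
                external≢block {proj₁ x} {proj₁ y} ex inb ∘ sym) extX) inM)) ⟩
      allOn (ssPair {d}) X X ∧ allOn (ssPair {d}) M M ∎
      where open ≡-Reasoning

    inversions-split : ∀ M v₀ v₁ v₂ v₃ → map contentLabel M ↭ canonicalBlock d i v₀ v₁ v₂ v₃ →
      countB (invPair {d}) (pairsOf (U ++ M ++ W)) ≡ countOn (contentInv d) Xs Xs + blockStat lo hi v₀ v₁ v₂ v₃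
    inversions-split M v₀ v₁ v₂ v₃ M↭K = begin
      countB (invPair {d}) (pairsOf (U ++ M ++ W))
        ≡⟨ countB-pairsOf (invPair {d}) (U ++ M ++ W) ⟩
      countOn (invPair {d}) (U ++ M ++ W) (U ++ M ++ W)
        ≡⟨ countOn-invPair (U ++ M ++ W) (U ++ M ++ W) ⟩
      countOn (contentInv d) (map contentLabel (U ++ M ++ W)) (map contentLabel (U ++ M ++ W))
        ≡⟨ countOn-↭ (contentInv d) to-canonical to-canonical ⟩
      countOn (contentInv d) (Xs ++ K) (Xs ++ K)
        ≡⟨ countOn-++-block (contentInv d) Xs K ⟩
      countOn (contentInv d) Xs Xs + (∑ (crossCount (contentInv d) Xs) K + countOn (contentInv d) K K)
        ≡⟨ cong (_+_ (countOn (contentInv d) Xs Xs))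
                (cong₂ _+_ (crossCount-block v₀ v₁ v₂ v₃) (countOn-canonicalBlock i v₀ v₁ v₂ v₃ 1<d)) ⟩
      countOn (contentInv d) Xs Xs + blockStat lo hi v₀ v₁ v₂ v₃ ∎
      where
      open ≡-Reasoning
      K : List (ℤ × ℕ)
      K = canonicalBlock d i v₀ v₁ v₂ v₃
      to-canonical : map contentLabel (U ++ M ++ W) ↭ Xs ++ K
      to-canonical = ↭-trans (map⁺ contentLabel (middle-to-end U M W))
                             (↭-trans (↭-reflexive (ListP.map-++ contentLabel X M)) (++⁺ˡ Xs M↭K))

    decompose : ∀ (B : List (TCell d)) vs s v₀ v₁ v₂ v₃ → length B ≡ length vs →
      All (InBlock ∘ proj₁) (zip B vs) →
      allOn (ssPair {d}) (zip B vs) (zip B vs) ≡ s →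
      map contentLabel (zip B vs) ↭ canonicalBlock d i v₀ v₁ v₂ v₃ →
      fillingOK (P ++ B ++ Q) (u ++ vs ++ w) ≡ s ∧ rest vs (blockStat lo hi v₀ v₁ v₂ v₃)
    decompose B vs s v₀ v₁ v₂ v₃ |B|≡|vs| inM ssM M↭K = begin
      fillingOK (P ++ B ++ Q) (u ++ vs ++ w)
        ≡⟨ cong (λ Z → all (ssPair {d}) (pairsOf Z) ∧ weightOK ∧ ⌊ countB (invPair {d}) (pairsOf Z) ℕ.≟ k ⌋)
                zip≡ ⟩
      all (ssPair {d}) (pairsOf (U ++ M ++ W)) ∧ weightOK ∧ ⌊ countB (invPair {d}) (pairsOf (U ++ M ++ W)) ℕ.≟ k ⌋
        ≡⟨ cong₂ (λ b n → b ∧ weightOK ∧ ⌊ n ℕ.≟ k ⌋)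
                 (trans (semistandard-split M inM) (cong (allOn (ssPair {d}) X X ∧_) ssM))
                 (inversions-split M v₀ v₁ v₂ v₃ M↭K) ⟩
      (allOn (ssPair {d}) X X ∧ s) ∧ weightOK ∧ ⌊ countOn (contentInv d) Xs Xs + blockStat lo hi v₀ v₁ v₂ v₃ ℕ.≟ k ⌋
        ≡⟨ trans (cong (_∧ _) (∧-comm (allOn (ssPair {d}) X X) s)) (∧-assoc s _ _) ⟩
      s ∧ rest vs (blockStat lo hi v₀ v₁ v₂ v₃) ∎
      where
      open ≡-Reasoning
      M : List (Labelled {d})
      M = zip B vs
      weightOK : Bool
      weightOK = ⌊ ≡-dec ℕ._≟_ (weight m (u ++ vs ++ w)) α ⌋
      zip≡ : zip (P ++ B ++ Q) (u ++ vs ++ w) ≡ U ++ M ++ W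
      zip≡ = trans (zip-++ P (B ++ Q) u (vs ++ w) |P|≡|u|) (cong (U ++_) (zip-++ B Q vs w |B|≡|vs|))

    decompose-HV : ∀ r s a b c e →
      fillingOK (P ++ blockHV r s ++ Q) (u ++ a ∷ b ∷ c ∷ e ∷ w)
        ≡ horizontalVertical a b c e ∧ rest (a ∷ b ∷ c ∷ e ∷ []) (blockStat lo hi a e b c)
    decompose-HV r s a b c e =
      decompose (blockHV r s) (a ∷ b ∷ c ∷ e ∷ []) (horizontalVertical a b c e) a e b c refl
        (inj₁ refl ∷ inj₁ refl ∷ inj₂ refl ∷ inj₂ refl ∷ [])
        (trans (allOn-ssPair-components H V I≢J (refl ∷ refl ∷ []) (refl ∷ refl ∷ []))
               (cong₂ _∧_ (allOn-horizontalDomino I r a b) (allOn-verticalDomino J s c e)))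
        (↭-trans (↭-reflexive (relabel (sc-I-diagonal r) (sc-I-superdiagonal r)
                                        (sc-J-superdiagonal s) (sc-J-diagonal (suc s))))
                 (prep _ (↭-trans (prep _ (swap _ _ refl)) (swap _ _ refl))))
      where
      H V : List (Labelled {d})
      H = zip (horizontalDomino I r) (a ∷ b ∷ [])
      V = zip (verticalDomino J s) (c ∷ e ∷ [])

    decompose-VH : ∀ r s a b c e →
      fillingOK (P ++ blockVH r s ++ Q) (u ++ a ∷ b ∷ c ∷ e ∷ w)
        ≡ verticalHorizontal a b c e ∧ rest (a ∷ b ∷ c ∷ e ∷ []) (blockStat lo hi b c a e)
    decompose-VH r s a b c e =
      decompose (blockVH r s) (a ∷ b ∷ c ∷ e ∷ []) (verticalHorizontal a b c e) b c a e refl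
        (inj₁ refl ∷ inj₁ refl ∷ inj₂ refl ∷ inj₂ refl ∷ [])
        (trans (allOn-ssPair-components V H I≢J (refl ∷ refl ∷ []) (refl ∷ refl ∷ []))
               (cong₂ _∧_ (allOn-verticalDomino I s a b) (allOn-horizontalDomino J r c e)))
        (↭-trans (↭-reflexive (relabel (sc-I-superdiagonal s) (sc-I-diagonal (suc s))
                                        (sc-J-diagonal r) (sc-J-superdiagonal r)))
                 (↭-trans (swap _ _ refl) (prep _ (swap _ _ refl))))
      where
      V H : List (Labelled {d})
      V = zip (verticalDomino I s) (a ∷ b ∷ [])
      H = zip (horizontalDomino J r) (c ∷ e ∷ [])

    fiber-swap : ∀ r s →
      ∑⁴ m (λ a b c e → 𝟙 (fillingOK (P ++ blockHV r s ++ Q) (u ++ a ∷ b ∷ c ∷ e ∷ w)))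
        ≡ ∑⁴ m (λ a b c e → 𝟙 (fillingOK (P ++ blockVH r s ++ Q) (u ++ a ∷ b ∷ c ∷ e ∷ w)))
    fiber-swap r s = begin
      _ ≡⟨ ∑⁴-cong m (λ a b c e → cong 𝟙 (decompose-HV r s a b c e)) ⟩
      _ ≡⟨ BlockSwap.block-swap m lo hi rest rest-↭ ⟩
      _ ≡⟨ sym (∑⁴-cong m (λ a b c e → cong 𝟙 (decompose-VH r s a b c e))) ⟩
      _ ∎
      where open ≡-Reasoning

  fillingCount-expand : ∀ P Q (B : List (TCell d)) → length B ≡ 4 →
    fillingCount (P ++ B ++ Q) ≡
      ∑ (λ u → ∑ (λ w → ∑⁴ m (λ a b c e → 𝟙 (fillingOK (P ++ B ++ Q) (u ++ a ∷ b ∷ c ∷ e ∷ w))))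
                 (words m (length Q)))
        (words m (length P))
  fillingCount-expand P Q B |B|≡4 = begin
    ∑ F (words m (length (P ++ B ++ Q)))
      ≡⟨ cong (λ n → ∑ F (words m n)) (trans (ListP.length-++ P) (cong (_+_ (length P)) length-B++Q)) ⟩
    ∑ F (words m (length P + (4 + length Q)))
      ≡⟨ ∑-words-+ m (length P) (4 + length Q) F ⟩
    ∑ (λ u → ∑ (λ t → F (u ++ t)) (words m (4 + length Q))) (words m (length P))
      ≡⟨ ∑-cong (words m (length P)) (λ u →
           trans (∑-words-+ m 4 (length Q) (λ t → F (u ++ t)))
          (trans (∑-comm (λ v w → F (u ++ v ++ w)) (words m 4) (words m (length Q)))
                 (∑-cong (words m (length Q)) (λ w → ∑-words-4 m (λ v → F (u ++ v ++ w)))))) ⟩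
    ∑ (λ u → ∑ (λ w → ∑⁴ m (λ a b c e → F (u ++ a ∷ b ∷ c ∷ e ∷ w))) (words m (length Q)))
      (words m (length P)) ∎
    where
    open ≡-Reasoning
    F : List ℕ → ℕ
    F T = 𝟙 (fillingOK (P ++ B ++ Q) T)
    length-B++Q : length (B ++ Q) ≡ 4 + length Q
    length-B++Q = trans (ListP.length-++ B) (cong (_+ length Q) |B|≡4)

  fillingCount-swap : ∀ P Q → All External P → All External Q → ∀ r s →
    fillingCount (P ++ blockHV r s ++ Q) ≡ fillingCount (P ++ blockVH r s ++ Q)
  fillingCount-swap P Q extP extQ r s = begin
    fillingCount (P ++ blockHV r s ++ Q)   ≡⟨ fillingCount-expand P Q (blockHV r s) refl ⟩
    _ ≡⟨ ∑-congᴬ (All.map (λ {u} |u|≡|P| → ∑-cong (words m (length Q)) (λ w →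
           Fiber.fiber-swap P Q extP extQ u w (sym |u|≡|P|) r s)) (words-length m (length P))) ⟩
    _ ≡⟨ sym (fillingCount-expand P Q (blockVH r s) refl) ⟩
    fillingCount (P ++ blockVH r s ++ Q) ∎
    where open ≡-Reasoning

  module Layout (lam : Tuple d) (hd : IsHorizontalDomino01 (lam I)) (vd : IsVerticalDomino01 (lam J)) where

    private module A = Around (around d i 1+i<d)

    r s : ℕ
    r = proj₁ hd
    s = proj₁ vd

    P Q : List (TCell d)
    P = concatMap (tagged lam) A.before
    Q = concatMap (tagged lam) A.after

    allFin≡ : allFin d ≡ A.before ++ I ∷ J ∷ A.after
    allFin≡ = trans A.allFin≡ (cong₂ (λ x y → A.before ++ x ∷ y ∷ A.after)
                                    (FinP.toℕ-injective (trans A.toℕ-left (sym toℕ-I)))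
                                    (FinP.toℕ-injective (trans A.toℕ-right (sym toℕ-J))))

    before-outside : All Outside A.before
    before-outside = All.map (λ j<i → ℕP.<⇒≢ j<i , ℕP.<⇒≢ (ℕP.m<n⇒m<1+n j<i)) A.before<k

    after-outside : All Outside A.after
    after-outside =
      All.map (λ 1+i<j → ℕP.<⇒≢ (ℕP.<-trans (ℕP.n<1+n i) 1+i<j) ∘ sym , ℕP.<⇒≢ 1+i<j ∘ sym) A.after>1+k

    extP : All External P
    extP = All-tagged lam before-outside

    extQ : All External Q
    extQ = All-tagged lam after-outside

    allCells-HV : allCells lam ≡ P ++ blockHV r s ++ Q
    allCells-HV = trans (cong (concatMap (tagged lam)) allFin≡)
                 (trans (ListP.concatMap-++ (tagged lam) A.before (I ∷ J ∷ A.after))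
                        (cong₂ (λ x y → P ++ x ++ y ++ Q)
                               (cong (map (I ,_)) (cells-horizontal (lam I) hd))
                               (cong (map (J ,_)) (cells-vertical (lam J) vd))))

    allCells-VH : allCells (swapTuple I J lam) ≡ P ++ blockVH r s ++ Q
    allCells-VH = trans (cong (concatMap (tagged μ)) allFin≡)
                 (trans (ListP.concatMap-++ (tagged μ) A.before (I ∷ J ∷ A.after))
                        (cong₂ _++_ (unchanged before-outside)
                          (cong₂ _++_ tagged-I (cong₂ _++_ tagged-J (unchanged after-outside)))))
      where
      μ : Tuple d
      μ = swapTuple I J lam
      tagged-I : tagged μ I ≡ verticalDomino I s
      tagged-I = cong (map (I ,_)) (trans (cong cells (swapTuple-left I J lam)) (cells-vertical (lam J) vd))
      tagged-J : tagged μ J ≡ horizontalDomino J r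
      tagged-J = cong (map (J ,_))
                      (trans (cong cells (swapTuple-right I J lam I≢J)) (cells-horizontal (lam I) hd))
      unchanged : ∀ {js} → All Outside js → concatMap (tagged μ) js ≡ concatMap (tagged lam) js
      unchanged outside = cong concat (ListP.map-cong-local (All.map (λ {j} (j≢i , j≢1+i) →
        cong (λ t → map (j ,_) (cells t))
             (swapTuple-other I J lam (j≢i ∘ cong-toℕ toℕ-I) (j≢1+i ∘ cong-toℕ toℕ-J))) outside))
        where
        cong-toℕ : ∀ {j j' : Fin d} {n} → toℕ j' ≡ n → j ≡ j' → toℕ j ≡ n
        cong-toℕ toℕ-j' j≡j' = trans (cong toℕ j≡j') toℕ-j'

lemma5p5 : (d : ℕ) → 2 ≤ d → (lam : Tuple d) → (i : ℕ) → (h : suc i < d) →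
    IsHorizontalDomino01 (lam (posI i h)) →
    IsVerticalDomino01 (lam (posI+1 i h)) →
    (α : List ℕ) → (k : ℕ) →
    coeffG lam α k ≡ coeffG (swapTuple (posI i h) (posI+1 i h) lam) α k
-- 2 ≤ d is implied by suc i < d
lemma5p5 d _ lam i h hd vd α k = begin
  coeffG lam α k                        ≡⟨ cong fillingCount allCells-HV ⟩
  fillingCount (P ++ blockHV r s ++ Q)  ≡⟨ fillingCount-swap P Q extP extQ r s ⟩
  fillingCount (P ++ blockVH r s ++ Q)  ≡⟨ cong fillingCount allCells-VH ⟨
  coeffG (swapTuple I J lam) α k        ∎
  where
  open ≡-Reasoning
  open DominoSwap d i h α k
  open Layout lam hd vd
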